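{- Let $(N,G)$ be a nearly ordered permutation group having a nonidentity bounded element, and suppose $N$ is Dedekind complete. The following are equivalent: (1) $(N,G)$ is highly approximately $o$-transitive; (2) $(N,G)$ is approximately 2-upward-transitive (in the linear/monotonic case), respectively approximately 3-outward-transitive (in the circular/monocircular case); (3) $(N,G)$ is locally sweeping.
   Context: Let $L$ be a dense linear order. A nearly ordered permutation group $(N,G)$, $G\le\mathrm{Aut}(N)$, is linear ($N=(L,<)$, $L$ without endpoints, order-preserving bijections), monotonic ($N=\mathrm{ED}(L)$, $L$ without endpoints, order-preserving or order-reversing bijections of $L$), circular ($N=C=(L,\mathrm{Cr})$, $L$ with at most one endpoint, $\mathrm{Cr}(x,y,z)$ iff $x<y<z$ or $y<z<x$ or $z<x<y$, $\mathrm{Cr}$-preserving bijections) or monocircular (bijections preserving or reversing $\mathrm{Cr}$). $N$ is Dedekind complete if it equals its Dedekind completion (in the circular case: the underlying order completed, with one endpoint adjoined if none). $\mathrm{Opp}(G)$ is the subgroup of order- (orientation-) preserving elements. $\mathrm{supp}(g)=\{x:g(x)\ne x\}$; $g$ is bounded if its support lies in a bounded interval: $(x,y)$, $x<y$ (linear/monotonic) or $(x,y)=\{z:\mathrm{Cr}(x,z,y)\}$, $x\ne y$ (circular). Approximately $n$-$o$-transitive: for $a_1<\dots<a_n$ in $L$ and intervals $I_1<\dots<I_n$ (circular: $\mathrm{Cr}(a_i,a_j,a_k)$ for $i<j<k$ and the analogous condition $\mathrm{Crs}$ on the intervals, with $n=2$ meaning distinct/disjoint), some $g\in G$ has $g(a_k)\in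 I_k$ for all $k$; highly = for all $n$. Approximately 2-upward-transitive: for any $a<b<c$ in $L$ and any interval $I\ni a$ there is $g\in\mathrm{Opp}(G)$ with $g(a)\in I$ and $g(b)>c$. Approximately 3-outward-transitive: for any $a\in C$, $b,c\in C$ with $\mathrm{Cr}(b,a,c)$, and bounded intervals $I\subseteq J$ with $a\in I$, there is $g\in G$ with $g(a)\in I$ and $g(b),g(c)\notin J$. Locally sweeping: for every bounded interval $I$ and every $a\in I$ there is $g\in G$ with $\mathrm{supp}(g)\subseteq I$ and $g(a)\ne a$. -}

module Defs where

open import Level using (Level; suc; _⊔_)
open import Data.Nat using (ℕ)
open import Data.Fin as Fin using (Fin)
open import Data.Product using (Σ; ∃; _×_; _,_)
open import Data.Sum using (_⊎_)
open import Relation.Nullary using (¬_)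
open import Data.Empty using (⊥)
open import Relation.Binary.PropositionalEquality using (_≡_; _≢_)
open import Relation.Binary.Structures using (IsStrictTotalOrder)

record DLO (ℓ : Level) : Set (suc ℓ) where
  field
    Carrier : Set ℓ
    _<_     : Carrier → Carrier → Set ℓ
    isSTO   : IsStrictTotalOrder _≡_ _<_
    dense   : ∀ {x y} → x < y → ∃ λ z → x < z × z < y

data Kind : Set where
  linear monotonic circular monocircular : Kind

data Shape : Set where
  lin circ : Shape

shape : Kind → Shape
shape linear       = lin
shape monotonic    = lin
shape circular     = circ
shape monocircular = circ

record Perm {ℓ} (L : Set ℓ) : Set ℓ where
  field
    to      : L → L
    from    : L → L
    to-from : ∀ x → to (from x) ≡ x
    from-to : ∀ x → from (to x) ≡ x

module _ {ℓ} {L : Set ℓ} where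
  open Perm

  idP : Perm L
  idP = record { to = λ x → x ; from = λ x → x
               ; to-from = λ _ → _≡_.refl ; from-to = λ _ → _≡_.refl }

  _∘P_ : Perm L → Perm L → Perm L
  p ∘P q = record
    { to = λ x → to p (to q x)
    ; from = λ x → from q (from p x)
    ; to-from = λ x → Relation.Binary.PropositionalEquality.trans
        (Relation.Binary.PropositionalEquality.cong (to p) (to-from q (from p x))) (to-from p x)
    ; from-to = λ x → Relation.Binary.PropositionalEquality.trans
        (Relation.Binary.PropositionalEquality.cong (from q) (from-to p (to q x))) (from-to q x)
    }

  invP : Perm L → Perm L
  invP p = record { to = from p ; from = to p ; to-from = from-to p ; from-to = to-from p }

module _ {ℓ} (D : DLO ℓ) where
  open DLO D renaming (Carrier to L)

  _≤L_ : L → L → Set ℓ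
  x ≤L y = x < y ⊎ x ≡ y

  Cr : L → L → L → Set ℓ
  Cr x y z = (x < y × y < z) ⊎ (y < z × z < x) ⊎ (z < x × x < y)

  HasMin HasMax NoMin NoMax : Set ℓ
  HasMin = ∃ λ m → ∀ x → m ≤L x
  HasMax = ∃ λ m → ∀ x → x ≤L m
  NoMin  = ∀ x → ∃ λ y → y < x
  NoMax  = ∀ x → ∃ λ y → x < y

  EndpointCond : Kind → Set ℓ
  EndpointCond k with shape k
  ... | lin  = NoMin × NoMax
  ... | circ = ¬ (HasMin × HasMax)

  OrderPres OrderRev CrPres CrRev : (L → L) → Set ℓ
  OrderPres f = ∀ x y → x < y → f x < f y
  OrderRev  f = ∀ x y → x < y → f y < f x
  CrPres f = ∀ x y z → Cr x y z → Cr (f x) (f y) (f z)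
  CrRev  f = ∀ x y z → Cr x y z → Cr (f z) (f y) (f x)

  IsAut : Kind → (L → L) → Set ℓ
  IsAut linear       f = OrderPres f
  IsAut monotonic    f = OrderPres f ⊎ OrderRev f
  IsAut circular     f = CrPres f
  IsAut monocircular f = CrPres f ⊎ CrRev f

  IsOpp : Kind → (L → L) → Set ℓ
  IsOpp k f with shape k
  ... | lin  = OrderPres f
  ... | circ = CrPres f

  ValidInterval : Kind → L → L → Set ℓ
  ValidInterval k x y with shape k
  ... | lin  = x < y
  ... | circ = x ≢ y

  InI : Kind → L → L → L → Set ℓ
  InI k x y z with shape k
  ... | lin  = x < z × z < y
  ... | circ = Cr x z y

  Interval : Kind → Set ℓ
  Interval k = Σ (L × L) λ { (x , y) → ValidInterval k x y }

  _∈[_]_ : L → (k : Kind) → Interval k → Set ℓ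
  z ∈[ k ] ((x , y) , _) = InI k x y z

  LinDedekindComplete : Set (suc ℓ)
  LinDedekindComplete =
    (A : L → Set ℓ) → (∃ λ x → A x) → (∃ λ u → ∀ x → A x → x ≤L u) →
    ∃ λ s → (∀ x → A x → x ≤L s) × (∀ u → (∀ x → A x → x ≤L u) → s ≤L u)

  -- N equals its Dedekind completion (circular case: completed order
  -- with one endpoint adjoined if none, so N must already have an endpoint)
  DedekindComplete : Kind → Set (suc ℓ)
  DedekindComplete k with shape k
  ... | lin  = LinDedekindComplete
  ... | circ = LinDedekindComplete × (HasMin ⊎ HasMax)

  record NOPG (k : Kind) : Set (suc ℓ) where
    field
      endpoints : EndpointCond k
      G         : Perm L → Set ℓ
      G-id      : G idP
      G-∘       : ∀ {p q} → G p → G q → G (p ∘P q)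
      G-inv     : ∀ {p} → G p → G (invP p)
      G-aut     : ∀ {p} → G p → IsAut k (Perm.to p)

  module _ {k : Kind} (N : NOPG k) where
    open NOPG N
    open Perm

    SuppIn : Perm L → Interval k → Set ℓ
    SuppIn g I = ∀ z → to g z ≢ z → z ∈[ k ] I

    HasNonidBoundedElement : Set ℓ
    HasNonidBoundedElement =
      ∃ λ g → G g × (∃ λ z → to g z ≢ z) × (∃ λ I → SuppIn g I)

    Config : (n : ℕ) → (Fin n → L) → (Fin n → Interval k) → Set ℓ
    Config n a I with shape k
    ... | lin  = ∀ i j → i Fin.< j →
                   a i < a j × (∀ x y → x ∈[ k ] I i → y ∈[ k ] I j → x < y)
    ... | circ = (∀ i j → i ≢ j →
                   a i ≢ a j × (∀ x → x ∈[ k ] I i → x ∈[ k ] I j → ⊥))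
               × (∀ i j l → i Fin.< j → j Fin.< l →
                   Cr (a i) (a j) (a l) ×
                   (∀ x y z → x ∈[ k ] I i → y ∈[ k ] I j → z ∈[ k ] I l → Cr x y z))

    ApproxNOTransitive : ℕ → Set ℓ
    ApproxNOTransitive n =
      (a : Fin n → L) (I : Fin n → Interval k) → Config n a I →
      ∃ λ g → G g × (∀ i → to g (a i) ∈[ k ] I i)

    HighlyApproxOTransitive : Set ℓ
    HighlyApproxOTransitive = ∀ n → ApproxNOTransitive n

    Approx2UpwardTransitive : Set ℓ
    Approx2UpwardTransitive =
      ∀ a b c → a < b → b < c → (I : Interval k) → a ∈[ k ] I →
      ∃ λ g → G g × IsOpp k (to g) × to g a ∈[ k ] I × c < to g b

    Approx3OutwardTransitive : Set ℓ
    Approx3OutwardTransitive =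
      ∀ a b c → Cr b a c → (I J : Interval k) → (∀ z → z ∈[ k ] I → z ∈[ k ] J) →
      a ∈[ k ] I →
      ∃ λ g → G g × to g a ∈[ k ] I × ¬ (to g b ∈[ k ] J) × ¬ (to g c ∈[ k ] J)

    Condition2 : Set ℓ
    Condition2 with shape k
    ... | lin  = Approx2UpwardTransitive
    ... | circ = Approx3OutwardTransitive

    LocallySweeping : Set ℓ
    LocallySweeping =
      ∀ (I : Interval k) a → a ∈[ k ] I → ∃ λ g → G g × SuppIn g I × to g a ≢ a

-- By Dedekind completeness, the orbit of a point x under the order-preserving elements supported
-- in an interval (u , t) is cofinal in (x , t): an element pushing the supremum of the orbit up would
-- carry an orbit point beyond it. So if G is locally sweeping, points can be moved one at a time into
-- prescribed intervals, each by an element supported above the points already placed; on a circle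
-- one cuts at a point and works in its stabiliser. This gives (3) ⇒ (1), and (1) ⇒ (2) needs only
-- two, resp. three, points.
-- For (2) ⇒ (3), conjugate a bounded element f with z < f z so that the given point lands in
-- (z , f z) while the support of the conjugate moves into the given interval. On a circle outward
-- transitivity pushes both ends out of the support at once; on a line upward transitivity only
-- controls the upper end, and the lower end is found as the supremum of the achievable ones.

module Submission where

open import Defs
open import Level using (Level) renaming (suc to lsuc)
open import Data.Nat using (ℕ; zero; suc; z≤n; s≤s)
open import Data.Fin as Fin using (Fin)
open import Data.Vec.Functional using ([]; _∷_)
open import Data.Product using (Σ; ∃; _×_; _,_; proj₁; proj₂)
open import Data.Sum using (_⊎_; inj₁; inj₂)
open import Data.Empty using (⊥; ⊥-elim)
open import Function.Base using (flip; _∘_)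
open import Relation.Nullary using (¬_; Dec; yes; no)
open import Relation.Binary.Core using (Rel)
open import Relation.Binary.Definitions using (Dense; Tri; tri<; tri≈; tri>)
open import Relation.Binary.Structures using (IsStrictTotalOrder)
import Relation.Binary.Construct.Flip.EqAndOrd as Flip
open import Relation.Binary.PropositionalEquality
open import Function.Bundles using (_⇔_; mk⇔)
open import Axiom.ExcludedMiddle using (ExcludedMiddle)

open Perm

module _ {ℓ} {L : Set ℓ} (_≤_ : Rel L ℓ) where

  UpperBound : (L → Set ℓ) → L → Set ℓ
  UpperBound A u = ∀ x → A x → x ≤ u

  IsSupremum : (L → Set ℓ) → L → Set ℓ
  IsSupremum A s = UpperBound A s × (∀ u → UpperBound A u → s ≤ u)

  Complete : Set (lsuc ℓ)
  Complete = (A : L → Set ℓ) → ∃ A → ∃ (UpperBound A) → ∃ (IsSupremum A)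

record CompleteDenseOrder {ℓ} (L : Set ℓ) : Set (lsuc ℓ) where
  infix 4 _⊏_ _⊑_
  field
    _⊏_                : Rel L ℓ
    isStrictTotalOrder : IsStrictTotalOrder _≡_ _⊏_
    dense              : Dense _⊏_

  _⊑_ : Rel L ℓ
  x ⊑ y = x ⊏ y ⊎ x ≡ y

  field
    complete : Complete _⊑_

  open IsStrictTotalOrder isStrictTotalOrder public
    using (asym; compare) renaming (trans to ⊏-trans)

  ⊏-irrefl : ∀ {x} → ¬ x ⊏ x
  ⊏-irrefl = IsStrictTotalOrder.irrefl isStrictTotalOrder refl

  ⊏⇒≢ : ∀ {x y} → x ⊏ y → x ≢ y
  ⊏⇒≢ x⊏y refl = ⊏-irrefl x⊏y

  ⊑-⊏-trans : ∀ {x y z} → x ⊑ y → y ⊏ z → x ⊏ z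
  ⊑-⊏-trans (inj₁ x⊏y) y⊏z = ⊏-trans x⊏y y⊏z
  ⊑-⊏-trans (inj₂ refl) y⊏z = y⊏z

  ⊏-⊑-trans : ∀ {x y z} → x ⊏ y → y ⊑ z → x ⊏ z
  ⊏-⊑-trans x⊏y (inj₁ y⊏z) = ⊏-trans x⊏y y⊏z
  ⊏-⊑-trans x⊏y (inj₂ refl) = x⊏y

  ⊏⇒⋣ : ∀ {x y} → x ⊏ y → ¬ y ⊑ x
  ⊏⇒⋣ x⊏y (inj₁ y⊏x) = asym x⊏y y⊏x
  ⊏⇒⋣ x⊏y (inj₂ refl) = ⊏-irrefl x⊏y

  ⊏̸⇒⊒ : ∀ {x y} → ¬ x ⊏ y → y ⊑ x
  ⊏̸⇒⊒ {x} {y} x⊏̸y with compare x y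
  ... | tri< x⊏y _ _ = ⊥-elim (x⊏̸y x⊏y)
  ... | tri≈ _ x≡y _ = inj₂ (sym x≡y)
  ... | tri> _ _ y⊏x = inj₁ y⊏x

  min : ∀ x y → ∃ λ m → m ⊑ x × m ⊑ y × (∀ {w} → w ⊏ x → w ⊏ y → w ⊏ m)
  min x y with compare x y
  ... | tri< x⊏y _ _ = x , inj₂ refl , inj₁ x⊏y , (λ w⊏x _ → w⊏x)
  ... | tri≈ _ x≡y _ = x , inj₂ refl , inj₂ x≡y , (λ w⊏x _ → w⊏x)
  ... | tri> _ _ y⊏x = y , inj₁ y⊏x , inj₂ refl , (λ _ w⊏y → w⊏y)

  max : ∀ x y → ∃ λ m → x ⊑ m × y ⊑ m × (∀ {w} → x ⊏ w → y ⊏ w → m ⊏ w)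
  max x y with compare x y
  ... | tri< x⊏y _ _ = y , inj₁ x⊏y , inj₂ refl , (λ _ y⊏w → y⊏w)
  ... | tri≈ _ x≡y _ = y , inj₂ x≡y , inj₂ refl , (λ _ y⊏w → y⊏w)
  ... | tri> _ _ y⊏x = x , inj₂ refl , inj₁ y⊏x , (λ x⊏w _ → x⊏w)

  module _ (em : ExcludedMiddle ℓ) where

    below-supremum : ∀ {A s w} → IsSupremum _⊑_ A s → w ⊏ s → ∃ λ z → A z × w ⊏ z
    below-supremum {A} {w = w} (_ , least) w⊏s with em {∃ λ z → A z × w ⊏ z}
    ... | yes found = found
    ... | no none = ⊥-elim (⊏⇒⋣ w⊏s (least w (λ x Ax → ⊏̸⇒⊒ (λ w⊏x → none (x , Ax , w⊏x)))))

dual : ∀ {ℓ} {L : Set ℓ} → CompleteDenseOrder L → CompleteDenseOrder L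
dual {ℓ} {L} O = record
  { _⊏_                = flip _⊏_
  ; isStrictTotalOrder = Flip.isStrictTotalOrder isStrictTotalOrder
  ; dense              = λ y⊏x → let (z , y⊏z , z⊏x) = dense y⊏x in z , z⊏x , y⊏z
  ; complete           = infimum
  }
  where
  open CompleteDenseOrder O
  _⊒_ : Rel L ℓ
  x ⊒ y = y ⊏ x ⊎ x ≡ y
  ⊑⇒⊒ : ∀ {x y} → x ⊑ y → y ⊒ x
  ⊑⇒⊒ (inj₁ x⊏y) = inj₁ x⊏y
  ⊑⇒⊒ (inj₂ refl) = inj₂ refl
  ⊒⇒⊑ : ∀ {x y} → y ⊒ x → x ⊑ y
  ⊒⇒⊑ (inj₁ x⊏y) = inj₁ x⊏y
  ⊒⇒⊑ (inj₂ refl) = inj₂ refl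
  infimum : Complete _⊒_
  infimum A (a , Aa) (b , b-lower) =
    let LowerBound = λ l → ∀ x → A x → l ⊑ x
        (s , s-upper , s-least) = complete LowerBound
          (b , λ x Ax → ⊒⇒⊑ (b-lower x Ax)) (a , λ l l-lower → l-lower a Aa)
    in s , (λ x Ax → ⊑⇒⊒ (s-least x (λ l l-lower → l-lower x Ax)))
         , (λ l l-lower → ⊑⇒⊒ (s-upper l (λ x Ax → ⊒⇒⊑ (l-lower x Ax))))

module _ {ℓ} {L : Set ℓ} where

  Supp⊆ : Perm L → (L → Set ℓ) → Set ℓ
  Supp⊆ g P = ∀ z → to g z ≢ z → P z

  supp-id : ∀ {P} → Supp⊆ idP P
  supp-id z moved = ⊥-elim (moved refl)

  supp-mono : ∀ {g} {P Q : L → Set ℓ} → (∀ {z} → P z → Q z) → Supp⊆ g P → Supp⊆ g Q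
  supp-mono P⊆Q g⊆P z moved = P⊆Q (g⊆P z moved)

  to-injective : ∀ (k : Perm L) {x y} → to k x ≡ to k y → x ≡ y
  to-injective k {x} {y} eq = trans (sym (from-to k x)) (trans (cong (from k) eq) (from-to k y))

  from-injective : ∀ (k : Perm L) {x y} → from k x ≡ from k y → x ≡ y
  from-injective k = to-injective (invP k)

  conj : Perm L → Perm L → Perm L
  conj k f = k ∘P (f ∘P invP k)

  conj-moves : ∀ {k f w} → to f (from k w) ≢ from k w → to (conj k f) w ≢ w
  conj-moves {k} moved eq = moved (trans (sym (from-to k _)) (cong (from k) eq))

  module _ (em : ExcludedMiddle ℓ) where

    fixed-outside : ∀ {g P z} → Supp⊆ g P → ¬ P z → to g z ≡ z
    fixed-outside {g} {z = z} g⊆P ¬Pz with em {to g z ≡ z}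
    ... | yes fixed = fixed
    ... | no moved = ⊥-elim (¬Pz (g⊆P z moved))

    supp-∘ : ∀ {p q P} → Supp⊆ p P → Supp⊆ q P → Supp⊆ (p ∘P q) P
    supp-∘ {p} {q} p⊆P q⊆P z moved with em {to q z ≡ z}
    ... | yes fixed = p⊆P z (λ eq → moved (trans (cong (to p) fixed) eq))
    ... | no q-moves = q⊆P z q-moves

    supp-inv : ∀ {p P} → Supp⊆ p P → Supp⊆ (invP p) P
    supp-inv {p} {P} p⊆P z moved with em {P z}
    ... | yes Pz = Pz
    ... | no ¬Pz = ⊥-elim (moved (trans (cong (from p) (sym (fixed-outside {p} p⊆P ¬Pz))) (from-to p z)))

    supp-conj : ∀ {k f P} → Supp⊆ f P → Supp⊆ (conj k f) (λ w → P (from k w))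
    supp-conj {k} {f} f⊆P w moved with em {to f (from k w) ≡ from k w}
    ... | yes fixed = ⊥-elim (moved (trans (cong (to k) fixed) (to-from k w)))
    ... | no f-moves = f⊆P _ f-moves

record OrderPreservingGroup {ℓ} {L : Set ℓ} (O : CompleteDenseOrder L) : Set (lsuc ℓ) where
  open CompleteDenseOrder O
  field
    H      : Perm L → Set ℓ
    H-id   : H idP
    H-∘    : ∀ {p q} → H p → H q → H (p ∘P q)
    H-inv  : ∀ {p} → H p → H (invP p)
    H-mono : ∀ {p} → H p → ∀ {x y} → x ⊏ y → to p x ⊏ to p y

dualGroup : ∀ {ℓ} {L : Set ℓ} {O : CompleteDenseOrder L} →
            OrderPreservingGroup O → OrderPreservingGroup (dual O)
dualGroup S = record
  { H = H ; H-id = H-id ; H-∘ = H-∘ ; H-inv = H-inv ; H-mono = λ Hp y⊏x → H-mono Hp y⊏x }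
  where open OrderPreservingGroup S

module LocalDynamics {ℓ} {L : Set ℓ} (O : CompleteDenseOrder L) (em : ExcludedMiddle ℓ)
                     (S : OrderPreservingGroup O) where
  open CompleteDenseOrder O
  open OrderPreservingGroup S

  Between : L → L → L → Set ℓ
  Between u v z = u ⊏ z × z ⊏ v

  IsLocallySweeping : Set ℓ
  IsLocallySweeping = ∀ {u v a} → Between u v a → ∃ λ h → H h × Supp⊆ h (Between u v) × to h a ≢ a

  OpenInterval : Set ℓ
  OpenInterval = Σ (L × L) λ p → proj₁ p ⊏ proj₂ p

  _∈_ : L → OpenInterval → Set ℓ
  z ∈ ((x , y) , _) = Between x y z

  Increasing : (n : ℕ) → (Fin n → L) → (Fin n → OpenInterval) → Set ℓ
  Increasing n a I = ∀ i j → i Fin.< j → a i ⊏ a j × (∀ x y → x ∈ I i → y ∈ I j → x ⊏ y)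

  increasing-head : ∀ {n a I} → Increasing (suc n) a I → ∀ i →
                    a Fin.zero ⊏ a (Fin.suc i) × (∀ x y → x ∈ I Fin.zero → y ∈ I (Fin.suc i) → x ⊏ y)
  increasing-head increasing i = increasing Fin.zero (Fin.suc i) (s≤s z≤n)

  increasing-tail : ∀ {n a I} → Increasing (suc n) a I → Increasing n (a ∘ Fin.suc) (I ∘ Fin.suc)
  increasing-tail increasing i j i<j = increasing (Fin.suc i) (Fin.suc j) (s≤s i<j)

  increasing-bounded-below : ∀ {n lo a I} → Increasing (suc n) a I →
                             lo ⊏ a Fin.zero → lo ⊑ proj₁ (proj₁ (I Fin.zero)) →
                             (∀ i → lo ⊏ a i) × (∀ i x → x ∈ I i → lo ⊏ x)
  increasing-bounded-below {a = a} {I} increasing lo⊏a₀ lo⊑I₀ =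
    (λ { Fin.zero → lo⊏a₀
       ; (Fin.suc i) → ⊏-trans lo⊏a₀ (proj₁ (increasing-head {a = a} {I} increasing i)) }) ,
    (λ { Fin.zero x (I₀⊏x , _) → ⊑-⊏-trans lo⊑I₀ I₀⊏x
       ; (Fin.suc i) x x∈I →
           let (c , I₀⊏c , c⊏I₀) = dense (proj₂ (I Fin.zero))
               I₀⊏x = proj₂ (increasing-head {a = a} {I} increasing i) c x (I₀⊏c , c⊏I₀) x∈I
           in ⊑-⊏-trans lo⊑I₀ (⊏-trans I₀⊏c I₀⊏x) })

  increasing-pair : ∀ {a₀ a₁ I₀ I₁} → a₀ ⊏ a₁ → (∀ x y → x ∈ I₀ → y ∈ I₁ → x ⊏ y) →
                    Increasing 2 (a₀ ∷ a₁ ∷ []) (I₀ ∷ I₁ ∷ [])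
  increasing-pair a₀⊏a₁ I₀⊏I₁ Fin.zero (Fin.suc Fin.zero) _ = a₀⊏a₁ , I₀⊏I₁
  increasing-pair _ _ Fin.zero Fin.zero ()
  increasing-pair _ _ (Fin.suc Fin.zero) Fin.zero ()
  increasing-pair _ _ (Fin.suc Fin.zero) (Fin.suc Fin.zero) (s≤s ())

  from-below : ∀ {h x y} → H h → x ⊏ to h y → from h x ⊏ y
  from-below {h} {x} {y} Hh x⊏hy = subst (from h x ⊏_) (from-to h y) (H-mono (H-inv Hh) x⊏hy)

  from-above : ∀ {h x y} → H h → to h y ⊏ x → y ⊏ from h x
  from-above {h} {x} {y} Hh hy⊏x = subst (_⊏ from h x) (from-to h y) (H-mono (H-inv Hh) hy⊏x)

  to-above : ∀ {h x y} → H h → from h x ⊏ y → x ⊏ to h y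
  to-above {h} {x} {y} Hh h⁻¹x⊏y = subst (_⊏ to h y) (to-from h x) (H-mono Hh h⁻¹x⊏y)

  to-below : ∀ {h x y} → H h → y ⊏ from h x → to h y ⊏ x
  to-below {h} {x} {y} Hh y⊏h⁻¹x = subst (to h y ⊏_) (to-from h x) (H-mono Hh y⊏h⁻¹x)

  H-reflect : ∀ {h x y} → H h → to h x ⊏ to h y → x ⊏ y
  H-reflect {h} {x} Hh hx⊏hy = subst (_⊏ _) (from-to h x) (from-below Hh hx⊏hy)

  moves⇒pushes-up : ∀ {h P s} → H h → Supp⊆ h P → to h s ≢ s →
                    ∃ λ h′ → H h′ × Supp⊆ h′ P × s ⊏ to h′ s
  moves⇒pushes-up {h} {P} {s} Hh h⊆P moved with compare (to h s) s
  ... | tri< hs⊏s _ _ = invP h , H-inv Hh , supp-inv em {h} h⊆P , from-above Hh hs⊏s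
  ... | tri≈ _ fixed _ = ⊥-elim (moved fixed)
  ... | tri> _ _ s⊏hs = h , Hh , h⊆P , s⊏hs

  stays-below : ∀ {h u v x} → H h → Supp⊆ h (Between u v) → x ⊏ v → to h x ⊏ v
  stays-below {h} Hh h⊆uv x⊏v =
    subst (to h _ ⊏_) (fixed-outside em {h} h⊆uv (λ (_ , v⊏v) → ⊏-irrefl v⊏v)) (H-mono Hh x⊏v)

  LocalOrbit : L → L → L → L → Set ℓ
  LocalOrbit u t x z = ∃ λ h → H h × Supp⊆ h (Between u t) × to h x ≡ z

  local-orbit-∘ : ∀ {u t x z h} → LocalOrbit u t x z → H h → Supp⊆ h (Between u t) →
                  LocalOrbit u t x (to h z)
  local-orbit-∘ {h = h} (g , Hg , g⊆ut , refl) Hh h⊆ut =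
    h ∘P g , H-∘ Hh Hg , supp-∘ em {h} {g} h⊆ut g⊆ut , refl

  module Sweeping (sweep : IsLocallySweeping) where

    local-orbit-sup-outside : ∀ {u t x s} → IsSupremum _⊑_ (LocalOrbit u t x) s → ¬ Between u t s
    local-orbit-sup-outside sup s∈ut =
      let (h₀ , Hh₀ , h₀⊆ut , moved) = sweep s∈ut
          (h , Hh , h⊆ut , s⊏hs) = moves⇒pushes-up Hh₀ h₀⊆ut moved
          (z , Oz , h⁻¹s⊏z) = below-supremum em sup (from-below Hh s⊏hs)
      in ⊏⇒⋣ (to-above Hh h⁻¹s⊏z) (proj₁ sup _ (local-orbit-∘ Oz Hh h⊆ut))

    local-orbit-cofinal : ∀ {u x t t′} → u ⊏ x → x ⊏ t → t′ ⊏ t →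
                          ∃ λ h → H h × Supp⊆ h (Between u t) × t′ ⊏ to h x
    local-orbit-cofinal {u} {x} {t} {t′} u⊏x x⊏t t′⊏t with em {∃ λ z → LocalOrbit u t x z × t′ ⊏ z}
    ... | yes (_ , (h , Hh , h⊆ut , refl) , t′⊏hx) = h , Hh , h⊆ut , t′⊏hx
    ... | no none =
      let x∈Orbit = idP , H-id , supp-id , refl
          Orbit⊑t = λ { _ (h , Hh , h⊆ut , refl) → inj₁ (stays-below Hh h⊆ut x⊏t) }
          (s , sup) = complete (LocalOrbit u t x) (x , x∈Orbit) (t , Orbit⊑t)
          s⊑t′ = proj₂ sup t′ (λ z Oz → ⊏̸⇒⊒ (λ t′⊏z → none (z , Oz , t′⊏z)))
      in ⊥-elim (local-orbit-sup-outside sup (⊏-⊑-trans u⊏x (proj₁ sup x x∈Orbit) , ⊑-⊏-trans s⊑t′ t′⊏t))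

module LocalTransitivity {ℓ} {L : Set ℓ} (O : CompleteDenseOrder L) (em : ExcludedMiddle ℓ)
                         (S : OrderPreservingGroup O)
                         (sweep : LocalDynamics.IsLocallySweeping O em S) where
  open CompleteDenseOrder O
  open OrderPreservingGroup S
  open LocalDynamics O em S
  open Sweeping sweep
  module Dual = LocalDynamics (dual O) em (dualGroup S)

  dual-sweep : Dual.IsLocallySweeping
  dual-sweep (a⊏u , v⊏a) =
    let (h , Hh , h⊆vu , moved) = sweep (v⊏a , a⊏u)
    in h , Hh , supp-mono {g = h} (λ (v⊏z , z⊏u) → z⊏u , v⊏z) h⊆vu , moved

  local-orbit-coinitial : ∀ {v x t t′} → x ⊏ v → t ⊏ x → t ⊏ t′ →
                          ∃ λ h → H h × Supp⊆ h (Between t v) × to h x ⊏ t′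
  local-orbit-coinitial x⊏v t⊏x t⊏t′ =
    let (h , Hh , h⊆ , hx⊏t′) = Dual.Sweeping.local-orbit-cofinal dual-sweep x⊏v t⊏x t⊏t′
    in h , Hh , supp-mono {g = h} (λ (z⊏v , t⊏z) → t⊏z , z⊏v) h⊆ , hx⊏t′

  local-orbit-dense-below : ∀ {u v x t₁ t₂} → u ⊏ x → x ⊏ t₂ → t₁ ⊏ t₂ → t₂ ⊑ v →
                            ∃ λ h → H h × Supp⊆ h (Between u v) × Between t₁ t₂ (to h x)
  local-orbit-dense-below u⊏x x⊏t₂ t₁⊏t₂ t₂⊑v =
    let (h , Hh , h⊆ , t₁⊏hx) = local-orbit-cofinal u⊏x x⊏t₂ t₁⊏t₂
    in h , Hh , supp-mono {g = h} (λ (u⊏z , z⊏t₂) → u⊏z , ⊏-⊑-trans z⊏t₂ t₂⊑v) h⊆ ,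
       t₁⊏hx , stays-below Hh h⊆ x⊏t₂

  local-orbit-dense-above : ∀ {u v x t₁ t₂} → x ⊏ v → t₁ ⊏ x → t₁ ⊏ t₂ → u ⊑ t₁ →
                            ∃ λ h → H h × Supp⊆ h (Between u v) × Between t₁ t₂ (to h x)
  local-orbit-dense-above x⊏v t₁⊏x t₁⊏t₂ u⊑t₁ =
    let (h , Hh , h⊆ , hx⊏t₂) = local-orbit-coinitial x⊏v t₁⊏x t₁⊏t₂
        h⊆′ = supp-mono {g = h} (λ (t₁⊏z , z⊏v) → z⊏v , t₁⊏z) h⊆
    in h , Hh , supp-mono {g = h} (λ (t₁⊏z , z⊏v) → ⊑-⊏-trans u⊑t₁ t₁⊏z , z⊏v) h⊆ ,
       Dual.stays-below Hh h⊆′ t₁⊏x , hx⊏t₂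

  local-orbit-dense : ∀ {u v x t₁ t₂} → Between u v x → u ⊑ t₁ → t₁ ⊏ t₂ → t₂ ⊑ v →
                      ∃ λ h → H h × Supp⊆ h (Between u v) × Between t₁ t₂ (to h x)
  local-orbit-dense {x = x} {t₂ = t₂} (u⊏x , x⊏v) u⊑t₁ t₁⊏t₂ t₂⊑v with compare x t₂
  ... | tri< x⊏t₂ _ _ = local-orbit-dense-below u⊏x x⊏t₂ t₁⊏t₂ t₂⊑v
  ... | tri≈ _ refl _ = local-orbit-dense-above x⊏v t₁⊏t₂ t₁⊏t₂ u⊑t₁
  ... | tri> _ _ t₂⊏x = local-orbit-dense-above x⊏v (⊏-trans t₁⊏t₂ t₂⊏x) t₁⊏t₂ u⊑t₁

  module _ (noMax : ∀ x → ∃ λ y → x ⊏ y) where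

    move-one-above : ∀ {lo a} (I : OpenInterval) → lo ⊏ a → (∀ x → x ∈ I → lo ⊏ x) →
                     ∃ λ g → H g × Supp⊆ g (lo ⊏_) × to g a ∈ I
    move-one-above {a = a} ((x₀ , y₀) , x₀⊏y₀) lo⊏a lo⊏I =
      let (c , x₀⊏c , c⊏y₀) = dense x₀⊏y₀
          (m , m⊑a , m⊑c , below-m) = min a c
          (u , lo⊏u , u⊏m) = dense (below-m lo⊏a (lo⊏I c (x₀⊏c , c⊏y₀)))
          (M , a⊑M , c⊑M , _) = max a c
          (v , M⊏v) = noMax M
          (t , u⊑t , x₀⊑t , above-t) = max u x₀
          (h , Hh , h⊆uv , t⊏ha , ha⊏c) =
            local-orbit-dense (⊏-⊑-trans u⊏m m⊑a , ⊑-⊏-trans a⊑M M⊏v) u⊑t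
              (above-t (⊏-⊑-trans u⊏m m⊑c) x₀⊏c) (inj₁ (⊑-⊏-trans c⊑M M⊏v))
      in h , Hh , supp-mono {g = h} (λ (u⊏z , _) → ⊏-trans lo⊏u u⊏z) h⊆uv ,
         ⊑-⊏-trans x₀⊑t t⊏ha , ⊏-trans ha⊏c c⊏y₀

    -- The element placing the remaining points is supported above the image of the first one,
    -- so it leaves that image in place.
    move-increasing-above : ∀ n {lo} (a : Fin n → L) (I : Fin n → OpenInterval) → Increasing n a I →
                            (∀ i → lo ⊏ a i) → (∀ i x → x ∈ I i → lo ⊏ x) →
                            ∃ λ g → H g × Supp⊆ g (lo ⊏_) × (∀ i → to g (a i) ∈ I i)
    move-increasing-above zero a I _ _ _ = idP , H-id , supp-id , λ ()
    move-increasing-above (suc n) a I increasing lo⊏a lo⊏I =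
      let (g₀ , Hg₀ , g₀⊆ , g₀a₀∈I₀) = move-one-above (I Fin.zero) (lo⊏a Fin.zero) (lo⊏I Fin.zero)
          lo′ = to g₀ (a Fin.zero)
          head = increasing-head {a = a} {I} increasing
          (g₁ , Hg₁ , g₁⊆ , g₁g₀a∈I) =
            move-increasing-above n (to g₀ ∘ a ∘ Fin.suc) (I ∘ Fin.suc)
              (λ i j i<j → let (aᵢ⊏aⱼ , Iᵢ⊏Iⱼ) = increasing-tail {a = a} {I} increasing i j i<j
                           in H-mono Hg₀ aᵢ⊏aⱼ , Iᵢ⊏Iⱼ)
              (λ i → H-mono Hg₀ (proj₁ (head i)))
              (λ i x x∈I → proj₂ (head i) lo′ x g₀a₀∈I₀ x∈I)
          g₁-fixes-lo′ = fixed-outside em {g₁} g₁⊆ ⊏-irrefl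
          lo⊏lo′ = lo⊏I Fin.zero lo′ g₀a₀∈I₀
      in g₁ ∘P g₀ , H-∘ Hg₁ Hg₀ ,
         supp-∘ em {g₁} {g₀} (supp-mono {g = g₁} (⊏-trans lo⊏lo′) g₁⊆) g₀⊆ ,
         λ { Fin.zero → subst (_∈ I Fin.zero) (sym g₁-fixes-lo′) g₀a₀∈I₀
           ; (Fin.suc i) → g₁g₀a∈I i }

module LinearCase {ℓ} (em : ExcludedMiddle ℓ) (D : DLO ℓ) (complete : LinDedekindComplete D)
                  (noMin : NoMin D) (noMax : NoMax D)
                  (G : Perm (DLO.Carrier D) → Set ℓ) (G-id : G idP)
                  (G-∘ : ∀ {p q} → G p → G q → G (p ∘P q)) (G-inv : ∀ {p} → G p → G (invP p))
                  (G-monotone : ∀ {p} → G p → OrderPres D (to p) ⊎ OrderRev D (to p)) where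
  open DLO D renaming (Carrier to L)

  O : CompleteDenseOrder L
  O = record { _⊏_ = _<_ ; isStrictTotalOrder = isSTO ; dense = dense ; complete = complete }

  open CompleteDenseOrder O hiding (_⊏_; dense; complete)

  from-pres : ∀ {k} → OrderPres D (to k) → OrderPres D (from k)
  from-pres {k} k-pres x y x<y with compare (from k x) (from k y)
  ... | tri< k⁻¹x<k⁻¹y _ _ = k⁻¹x<k⁻¹y
  ... | tri≈ _ eq _ = ⊥-elim (⊏⇒≢ x<y (from-injective k eq))
  ... | tri> _ _ k⁻¹y<k⁻¹x =
    ⊥-elim (asym x<y (subst₂ _<_ (to-from k y) (to-from k x) (k-pres _ _ k⁻¹y<k⁻¹x)))

  Opp : OrderPreservingGroup O
  Opp = record
    { H      = λ g → G g × OrderPres D (to g)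
    ; H-id   = G-id , (λ _ _ x<y → x<y)
    ; H-∘    = λ (Gp , p-pres) (Gq , q-pres) → G-∘ Gp Gq , (λ _ _ x<y → p-pres _ _ (q-pres _ _ x<y))
    ; H-inv  = λ {p} (Gp , p-pres) → G-inv Gp , from-pres {p} p-pres
    ; H-mono = λ (_ , p-pres) x<y → p-pres _ _ x<y
    }

  open OrderPreservingGroup Opp using (H; H-∘; H-inv; H-mono)
  open LocalDynamics O em Opp

  HighlyApproxTransitive UpwardTransitive Sweeping BoundedElement : Set ℓ
  HighlyApproxTransitive =
    ∀ n a I → Increasing n a I → ∃ λ g → G g × (∀ i → to g (a i) ∈ I i)
  UpwardTransitive =
    ∀ a b c → a < b → b < c → (I : OpenInterval) → a ∈ I →
    ∃ λ g → G g × OrderPres D (to g) × to g a ∈ I × c < to g b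
  Sweeping = ∀ (I : OpenInterval) a → a ∈ I → ∃ λ g → G g × Supp⊆ g (_∈ I) × to g a ≢ a
  BoundedElement = ∃ λ g → G g × (∃ λ z → to g z ≢ z) × ∃ λ (I : OpenInterval) → Supp⊆ g (_∈ I)

  above : ∀ x y → ∃ λ m → x < m × y < m
  above x y = let (M , x⊑M , y⊑M , _) = max x y ; (m , M<m) = noMax M
              in m , ⊑-⊏-trans x⊑M M<m , ⊑-⊏-trans y⊑M M<m

  below : ∀ x y → ∃ λ m → m < x × m < y
  below x y = let (M , M⊑x , M⊑y , _) = min x y ; (m , m<M) = noMin M
              in m , ⊏-⊑-trans m<M M⊑x , ⊏-⊑-trans m<M M⊑y

  -- It fixes a point on each side of I, which an order-reversing map cannot do.
  bounded⇒order-preserving : ∀ {g} (I : OpenInterval) → G g → Supp⊆ g (_∈ I) → OrderPres D (to g)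
  bounded⇒order-preserving {g} ((x , y) , x<y) Gg g⊆I with G-monotone Gg
  ... | inj₁ g-pres = g-pres
  ... | inj₂ g-rev =
    let (p , p<x) = noMin x
        (q , y<q) = noMax y
        g-fixes-p = fixed-outside em {g} g⊆I (λ (x<p , _) → asym p<x x<p)
        g-fixes-q = fixed-outside em {g} g⊆I (λ (_ , q<y) → asym y<q q<y)
        p<q = ⊏-trans p<x (⊏-trans x<y y<q)
    in ⊥-elim (asym p<q (subst₂ _<_ g-fixes-q g-fixes-p (g-rev _ _ p<q)))

  sweeping⇒locally-sweeping : Sweeping → IsLocallySweeping
  sweeping⇒locally-sweeping sweep (u<a , a<v) =
    let I = (_ , _) , ⊏-trans u<a a<v
        (g , Gg , g⊆I , moved) = sweep I _ (u<a , a<v)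
    in g , (Gg , bounded⇒order-preserving I Gg g⊆I) , g⊆I , moved

  sweeping⇒highly-transitive : Sweeping → HighlyApproxTransitive
  sweeping⇒highly-transitive sweep zero a I _ = idP , G-id , λ ()
  sweeping⇒highly-transitive sweep (suc n) a I increasing =
    let (lo , lo<a₀ , lo<I₀) = below (a Fin.zero) (proj₁ (proj₁ (I Fin.zero)))
        (lo<a , lo<I) = increasing-bounded-below {a = a} {I} increasing lo<a₀ (inj₁ lo<I₀)
        (g , (Gg , _) , _ , moved) =
          LocalTransitivity.move-increasing-above O em Opp (sweeping⇒locally-sweeping sweep) noMax
            (suc n) a I increasing lo<a lo<I
    in g , Gg , moved

  preserves-pair⇒order-preserving : ∀ {g a b} → G g → a < b → to g a < to g b → OrderPres D (to g)
  preserves-pair⇒order-preserving {g} Gg a<b ga<gb with G-monotone Gg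
  ... | inj₁ g-pres = g-pres
  ... | inj₂ g-rev = ⊥-elim (asym ga<gb (g-rev _ _ a<b))

  highly-transitive⇒upward : HighlyApproxTransitive → UpwardTransitive
  highly-transitive⇒upward transitive a b c a<b b<c I@((u , v) , _) a∈I@(_ , a<v) =
    let (m , v<m , c<m) = above v c
        (m′ , m<m′) = noMax m
        J = (m , m′) , m<m′
        (g , Gg , moved) = transitive 2 (a ∷ b ∷ []) (I ∷ J ∷ [])
          (increasing-pair {I₀ = I} {J} a<b (λ x y (_ , x<v) (m<y , _) → ⊏-trans x<v (⊏-trans v<m m<y)))
        ga∈I = moved Fin.zero
        (m<gb , _) = moved (Fin.suc Fin.zero)
        ga<v = proj₂ ga∈I
    in g , Gg , preserves-pair⇒order-preserving Gg a<b (⊏-trans ga<v (⊏-trans v<m m<gb)) ,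
       ga∈I , ⊏-trans c<m m<gb

  push-beyond : UpwardTransitive → ∀ {a b} c → a < b → (I : OpenInterval) → a ∈ I →
                ∃ λ g → H g × to g a ∈ I × c < to g b
  push-beyond up {b = b} c a<b I a∈I =
    let (c′ , b<c′ , c<c′) = above b c
        (g , Gg , g-pres , ga∈I , c′<gb) = up _ _ c′ a<b b<c′ I a∈I
    in g , (Gg , g-pres) , ga∈I , ⊏-trans c<c′ c′<gb

  push-above : UpwardTransitive → ∀ x c → ∃ λ g → H g × c < to g x
  push-above up x c =
    let (w , w<x) = noMin x
        (w₀ , w₀<w) = noMin w
        (g , Hg , _ , c<gx) = push-beyond up c w<x ((w₀ , x) , ⊏-trans w₀<w w<x) (w₀<w , w<x)
    in g , Hg , c<gx

  pull-into : UpwardTransitive → ∀ {x t₁ t₂} → t₁ < t₂ → t₂ < x → ∃ λ g → H g × Between t₁ t₂ (to g x)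
  pull-into up {x} t₁<t₂ t₂<x =
    let (m , t₁<m , m<t₂) = dense t₁<t₂
        (b , m<b , b<t₂) = dense m<t₂
        (g , Hg , (_ , gm<b) , x<gb) = push-beyond up x m<b ((_ , b) , ⊏-trans t₁<m m<b) (t₁<m , m<b)
        gm<x = ⊏-trans gm<b (⊏-trans b<t₂ t₂<x)
    in invP g , H-inv {g} Hg , ⊏-trans t₁<m (from-above Hg gm<x) , ⊏-trans (from-below Hg x<gb) b<t₂

  move-into : UpwardTransitive → ∀ x {t₁ t₂} → t₁ < t₂ → ∃ λ g → H g × Between t₁ t₂ (to g x)
  move-into up x {t₂ = t₂} t₁<t₂ =
    let (g₁ , Hg₁ , t₂<g₁x) = push-above up x t₂
        (g₂ , Hg₂ , g₂g₁x∈) = pull-into up t₁<t₂ t₂<g₁x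
    in g₂ ∘P g₁ , H-∘ Hg₂ Hg₁ , g₂g₁x∈

  record Bump : Set ℓ where
    field
      f       : Perm L
      Hf      : H f
      x y z   : L
      f⊆xy    : Supp⊆ f (Between x y)
      z<fz    : z < to f z

  bounded⇒bump : BoundedElement → Bump
  bounded⇒bump (f₀ , Gf₀ , (z , moved) , I@((x , y) , _) , f₀⊆I) =
    let (f , Hf , f⊆I , z<fz) = moves⇒pushes-up (Gf₀ , bounded⇒order-preserving I Gf₀ f₀⊆I) f₀⊆I moved
    in record { f = f ; Hf = Hf ; x = x ; y = y ; z = z ; f⊆xy = f⊆I ; z<fz = z<fz }

  -- Conjugate the bump so that β lands in (z , f z) and the right end of its support below γ.
  bump-conjugate-below : UpwardTransitive → Bump → ∀ {β γ} → β < γ →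
                         ∃ λ e → H e × ∃ λ X → Supp⊆ e (Between X γ) × to e β ≢ β
  bump-conjugate-below up bump {β} {γ} β<γ =
    let (h₁ , Hh₁ , h₁β∈) = move-into up β z<fz
        (h₂ , Hh₂ , (z<gβ , gβ<fz) , y<gγ) = push-beyond up y (H-mono Hh₁ β<γ) ((z , to f z) , z<fz) h₁β∈
        g = h₂ ∘P h₁
        Hg = H-∘ Hh₂ Hh₁
    in conj (invP g) f , H-∘ (H-inv {g} Hg) (H-∘ Hf Hg) , from g x ,
       supp-mono {g = conj (invP g) f}
         (λ (x<gw , gw<y) → from-below Hg x<gw , H-reflect Hg (⊏-trans gw<y y<gγ))
         (supp-conj em {invP g} {f} f⊆xy) ,
       conj-moves {k = invP g} {f}
         (λ fgβ≡gβ → ⊏-irrefl (subst (to g β <_) fgβ≡gβ (⊏-trans gβ<fz (H-mono Hf z<gβ))))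
    where open Bump bump

  LowerEnd : L → L → L → Set ℓ
  LowerEnd v a X = ∃ λ e → H e × Supp⊆ e (Between X v) × to e a ≢ a

  lower-end-conj : ∀ {v a X X₀ γ d} → H d → Supp⊆ d (Between X₀ γ) → γ < a → a < v →
                   LowerEnd v a X → LowerEnd v a (to d X)
  lower-end-conj {v} {a} {d = d} Hd d⊆ γ<a a<v (e , He , e⊆Xv , moved) =
    conj d e , H-∘ Hd (H-∘ He (H-inv {d} Hd)) ,
    supp-mono {g = conj d e}
      (λ (X<d⁻¹w , d⁻¹w<v) → to-below Hd X<d⁻¹w , subst (_ <_) d-fixes-v (to-above Hd d⁻¹w<v))
      (supp-conj em {d} {e} e⊆Xv) ,
    conj-moves {k = d} {e} (subst (λ t → to e t ≢ t) (sym d⁻¹-fixes-a) moved)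
    where
    d-fixes-v : to d v ≡ v
    d-fixes-v = fixed-outside em {d} d⊆ (λ (_ , v<γ) → asym v<γ (⊏-trans γ<a a<v))
    d⁻¹-fixes-a : from d a ≡ a
    d⁻¹-fixes-a = fixed-outside em {invP d} (supp-inv em {d} d⊆) (λ (_ , a<γ) → asym a<γ γ<a)

  -- If the supremum s of the lower ends were below a, a bounded element pushing s up
  -- (supported below a) would conjugate some lower end beyond s.
  lower-end-sup-≮ : UpwardTransitive → Bump → ∀ {v a s} → a < v →
                    IsSupremum _⊑_ (LowerEnd v a) s → ¬ s < a
  lower-end-sup-≮ up bump a<v sup s<a =
    let (γ , s<γ , γ<a) = dense s<a
        (d₀ , Hd₀ , _ , d₀⊆ , moved) = bump-conjugate-below up bump s<γ
        (d , Hd , d⊆ , s<ds) = moves⇒pushes-up Hd₀ d₀⊆ moved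
        (X , LX , d⁻¹s<X) = below-supremum em sup (from-below Hd s<ds)
    in ⊏⇒⋣ (to-above Hd d⁻¹s<X) (proj₁ sup _ (lower-end-conj Hd d⊆ γ<a a<v LX))

  upward⇒sweeping : BoundedElement → UpwardTransitive → Sweeping
  upward⇒sweeping bounded up ((u , v) , _) a (u<a , a<v) with em {∃ λ X → LowerEnd v a X × u ⊑ X}
  ... | yes (X , (e , (Ge , _) , e⊆Xv , moved) , u⊑X) =
    e , Ge , supp-mono {g = e} (λ (X<w , w<v) → ⊑-⊏-trans u⊑X X<w , w<v) e⊆Xv , moved
  ... | no none =
    let bump = bounded⇒bump bounded
        (e₀ , He₀ , X₀ , e₀⊆ , moved) = bump-conjugate-below up bump a<v
        below-a = λ { X (e , _ , e⊆Xv , moved) → inj₁ (proj₁ (e⊆Xv a moved)) }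
        (s , sup) = complete (LowerEnd v a) (X₀ , e₀ , He₀ , e₀⊆ , moved) (a , below-a)
        s⊑u = proj₂ sup u (λ X LX → ⊏̸⇒⊒ (λ u<X → none (X , LX , inj₁ u<X)))
    in ⊥-elim (lower-end-sup-≮ up bump a<v sup (⊑-⊏-trans s⊑u u<a))

  equivalences : BoundedElement →
                 (HighlyApproxTransitive ⇔ UpwardTransitive) × (UpwardTransitive ⇔ Sweeping)
  equivalences bounded =
    mk⇔ highly-transitive⇒upward (sweeping⇒highly-transitive ∘ upward⇒sweeping bounded) ,
    mk⇔ (upward⇒sweeping bounded) (highly-transitive⇒upward ∘ sweeping⇒highly-transitive)

module CyclicOrder {ℓ} (D : DLO ℓ) where
  open DLO D renaming (Carrier to L)
  open IsStrictTotalOrder isSTO using (asym; compare) renaming (trans to <-trans)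

  Cyc : L → L → L → Set ℓ
  Cyc = Cr D

  <-irrefl : ∀ {x} → ¬ x < x
  <-irrefl = IsStrictTotalOrder.irrefl isSTO refl

  <⇒≢ : ∀ {x y} → x < y → x ≢ y
  <⇒≢ x<y refl = <-irrefl x<y

  <-cycle : ∀ {x y z} → x < y → y < z → z < x → ⊥
  <-cycle x<y y<z z<x = <-irrefl (<-trans x<y (<-trans y<z z<x))

  Cyc-resp : ∀ {x y z x′ y′ z′} → x ≡ x′ → y ≡ y′ → z ≡ z′ → Cyc x y z → Cyc x′ y′ z′
  Cyc-resp refl refl refl xyz = xyz

  Cyc-rotate : ∀ {x y z} → Cyc x y z → Cyc y z x
  Cyc-rotate (inj₁ xyz) = inj₂ (inj₂ xyz)
  Cyc-rotate (inj₂ (inj₁ yzx)) = inj₁ yzx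
  Cyc-rotate (inj₂ (inj₂ zxy)) = inj₂ (inj₁ zxy)

  Cyc-rotate⁻¹ : ∀ {x y z} → Cyc x y z → Cyc z x y
  Cyc-rotate⁻¹ = Cyc-rotate ∘ Cyc-rotate

  Cyc-distinct : ∀ {x y z} → Cyc x y z → x ≢ y × y ≢ z × x ≢ z
  Cyc-distinct (inj₁ (x<y , y<z)) =
    (λ { refl → <-irrefl x<y }) , (λ { refl → <-irrefl y<z }) , (λ { refl → asym x<y y<z })
  Cyc-distinct (inj₂ (inj₁ (y<z , z<x))) =
    (λ { refl → asym y<z z<x }) , (λ { refl → <-irrefl y<z }) , (λ { refl → <-irrefl z<x })
  Cyc-distinct (inj₂ (inj₂ (z<x , x<y))) =
    (λ { refl → <-irrefl x<y }) , (λ { refl → asym z<x x<y }) , (λ { refl → <-irrefl z<x })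

  Cyc-asym : ∀ {x y z} → Cyc x y z → ¬ Cyc z y x
  Cyc-asym (inj₁ (a , b)) (inj₁ (c , d)) = asym b c
  Cyc-asym (inj₁ (a , b)) (inj₂ (inj₁ (c , d))) = asym a c
  Cyc-asym (inj₁ (a , b)) (inj₂ (inj₂ (c , d))) = asym b d
  Cyc-asym (inj₂ (inj₁ (a , b))) (inj₁ (c , d)) = asym a c
  Cyc-asym (inj₂ (inj₁ (a , b))) (inj₂ (inj₁ (c , d))) = asym b d
  Cyc-asym (inj₂ (inj₁ (a , b))) (inj₂ (inj₂ (c , d))) = asym b c
  Cyc-asym (inj₂ (inj₂ (a , b))) (inj₁ (c , d)) = asym b d
  Cyc-asym (inj₂ (inj₂ (a , b))) (inj₂ (inj₁ (c , d))) = asym a d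
  Cyc-asym (inj₂ (inj₂ (a , b))) (inj₂ (inj₂ (c , d))) = asym a c

  Cyc-total : ∀ {x y z} → x ≢ y → y ≢ z → x ≢ z → Cyc x y z ⊎ Cyc z y x
  Cyc-total {x} {y} {z} x≢y y≢z x≢z with compare x y | compare y z | compare x z
  ... | tri≈ _ x≡y _ | _ | _ = ⊥-elim (x≢y x≡y)
  ... | _ | tri≈ _ y≡z _ | _ = ⊥-elim (y≢z y≡z)
  ... | _ | _ | tri≈ _ x≡z _ = ⊥-elim (x≢z x≡z)
  ... | tri< x<y _ _ | tri< y<z _ _ | _ = inj₁ (inj₁ (x<y , y<z))
  ... | tri< _ _ _ | tri> _ _ z<y | tri< x<z _ _ = inj₂ (inj₂ (inj₂ (x<z , z<y)))
  ... | tri< x<y _ _ | tri> _ _ _ | tri> _ _ z<x = inj₁ (inj₂ (inj₂ (z<x , x<y)))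
  ... | tri> _ _ y<x | tri< _ _ _ | tri< x<z _ _ = inj₂ (inj₂ (inj₁ (y<x , x<z)))
  ... | tri> _ _ _ | tri< y<z _ _ | tri> _ _ z<x = inj₁ (inj₂ (inj₁ (y<z , z<x)))
  ... | tri> _ _ y<x | tri> _ _ z<y | _ = inj₂ (inj₁ (z<y , y<x))

  -- Seen from a base point o, Cyc o x y says x comes before y.
  Cyc-trans : ∀ {o x y z} → Cyc o x y → Cyc o y z → Cyc o x z
  Cyc-trans (inj₁ (a , b)) (inj₁ (c , d)) = inj₁ (a , <-trans b d)
  Cyc-trans (inj₁ (a , b)) (inj₂ (inj₁ (c , d))) = ⊥-elim (<-cycle a (<-trans b c) d)
  Cyc-trans (inj₁ (a , b)) (inj₂ (inj₂ (c , d))) = inj₂ (inj₂ (c , a))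
  Cyc-trans (inj₂ (inj₁ (a , b))) (inj₁ (c , d)) = ⊥-elim (asym b c)
  Cyc-trans (inj₂ (inj₁ (a , b))) (inj₂ (inj₁ (c , d))) = inj₂ (inj₁ (<-trans a c , d))
  Cyc-trans (inj₂ (inj₁ (a , b))) (inj₂ (inj₂ (c , d))) = ⊥-elim (asym b d)
  Cyc-trans (inj₂ (inj₂ (a , b))) (inj₁ (c , d)) = ⊥-elim (asym a c)
  Cyc-trans (inj₂ (inj₂ (a , b))) (inj₂ (inj₁ (c , d))) = inj₂ (inj₂ (d , b))
  Cyc-trans (inj₂ (inj₂ (a , b))) (inj₂ (inj₂ (c , d))) = ⊥-elim (asym a d)

  Cyc-chain : ∀ {o x y z} → Cyc o x y → Cyc o y z → Cyc x y z
  Cyc-chain (inj₁ (a , b)) (inj₁ (c , d)) = inj₁ (b , d)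
  Cyc-chain (inj₁ (a , b)) (inj₂ (inj₁ (c , d))) = ⊥-elim (<-cycle a (<-trans b c) d)
  Cyc-chain (inj₁ (a , b)) (inj₂ (inj₂ (c , d))) = inj₂ (inj₂ (<-trans c a , b))
  Cyc-chain (inj₂ (inj₁ (a , b))) (inj₁ (c , d)) = ⊥-elim (asym b c)
  Cyc-chain (inj₂ (inj₁ (a , b))) (inj₂ (inj₁ (c , d))) = inj₁ (a , c)
  Cyc-chain (inj₂ (inj₁ (a , b))) (inj₂ (inj₂ (c , d))) = ⊥-elim (asym b d)
  Cyc-chain (inj₂ (inj₂ (a , b))) (inj₁ (c , d)) = ⊥-elim (asym a c)
  Cyc-chain (inj₂ (inj₂ (a , b))) (inj₂ (inj₁ (c , d))) = inj₂ (inj₁ (c , <-trans d b))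
  Cyc-chain (inj₂ (inj₂ (a , b))) (inj₂ (inj₂ (c , d))) = ⊥-elim (asym a d)

  Cyc-split : ∀ {o x y z} → Cyc o x z → Cyc x y z → Cyc o x y × Cyc o y z
  Cyc-split (inj₁ (a , b)) (inj₁ (c , d)) = inj₁ (a , c) , inj₁ (<-trans a c , d)
  Cyc-split (inj₁ (a , b)) (inj₂ (inj₁ (c , d))) = ⊥-elim (asym b d)
  Cyc-split (inj₁ (a , b)) (inj₂ (inj₂ (c , d))) = ⊥-elim (asym b c)
  Cyc-split (inj₂ (inj₁ (a , b))) (inj₁ (c , d)) = inj₂ (inj₁ (c , <-trans d b)) , inj₂ (inj₁ (d , b))
  Cyc-split (inj₂ (inj₁ (a , b))) (inj₂ (inj₁ (c , d))) = ⊥-elim (asym a d)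
  Cyc-split (inj₂ (inj₁ (a , b))) (inj₂ (inj₂ (c , d))) = ⊥-elim (asym a c)
  Cyc-split (inj₂ (inj₂ (a , b))) (inj₁ (c , d)) = ⊥-elim (<-cycle (<-trans c d) a b)
  Cyc-split (inj₂ (inj₂ (a , b))) (inj₂ (inj₁ (c , d))) =
    inj₂ (inj₂ (<-trans c a , b)) , inj₂ (inj₁ (c , a))
  Cyc-split (inj₂ (inj₂ (a , b))) (inj₂ (inj₂ (c , d))) = inj₁ (b , d) , inj₂ (inj₂ (a , <-trans b d))

module CutOrder {ℓ} (em : ExcludedMiddle ℓ) (D : DLO ℓ) (complete : LinDedekindComplete D)
                (not-both-ends : ¬ (HasMin D × HasMax D)) (some-end : HasMin D ⊎ HasMax D) where
  open DLO D renaming (Carrier to L)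
  open IsStrictTotalOrder isSTO using (asym; compare; _≟_) renaming (trans to <-trans)
  open CyclicOrder D

  _≤_ : L → L → Set ℓ
  _≤_ = _≤L_ D

  ≤-<-trans : ∀ {x y z} → x ≤ y → y < z → x < z
  ≤-<-trans (inj₁ x<y) y<z = <-trans x<y y<z
  ≤-<-trans (inj₂ refl) y<z = y<z

  <-≤-trans : ∀ {x y z} → x < y → y ≤ z → x < z
  <-≤-trans x<y (inj₁ y<z) = <-trans x<y y<z
  <-≤-trans x<y (inj₂ refl) = x<y

  exists-outside : ∀ {y x} → y < x → (∃ λ z → z < y) ⊎ (∃ λ z → x < z)
  exists-outside {y} {x} y<x with em {∃ λ z → z < y} | em {∃ λ z → x < z}
  ... | yes below | _ = inj₁ below
  ... | no _ | yes above = inj₂ above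
  ... | no none-below | no none-above = ⊥-elim (not-both-ends ((y , y-least) , (x , x-greatest)))
    where
    y-least : ∀ w → y ≤ w
    y-least w with compare y w
    ... | tri< y<w _ _ = inj₁ y<w
    ... | tri≈ _ y≡w _ = inj₂ y≡w
    ... | tri> _ _ w<y = ⊥-elim (none-below (w , w<y))
    x-greatest : ∀ w → w ≤ x
    x-greatest w with compare w x
    ... | tri< w<x _ _ = inj₁ w<x
    ... | tri≈ _ w≡x _ = inj₂ w≡x
    ... | tri> _ _ x<w = ⊥-elim (none-above (w , x<w))

  Cyc-dense : ∀ {x y} → x ≢ y → ∃ λ z → Cyc x z y
  Cyc-dense {x} {y} x≢y with compare x y
  ... | tri< x<y _ _ = let (z , x<z , z<y) = dense x<y in z , inj₁ (x<z , z<y)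
  ... | tri≈ _ x≡y _ = ⊥-elim (x≢y x≡y)
  ... | tri> _ _ y<x with exists-outside y<x
  ... | inj₁ (z , z<y) = z , inj₂ (inj₁ (z<y , y<x))
  ... | inj₂ (z , x<z) = z , inj₂ (inj₂ (y<x , x<z))

  ∉-arc : ∀ {x y w} → x ≢ y → ¬ Cyc x w y → w ≡ x ⊎ w ≡ y ⊎ Cyc y w x
  ∉-arc {x} {y} {w} x≢y w∉xy with w ≟ x | w ≟ y
  ... | yes w≡x | _ = inj₁ w≡x
  ... | no _ | yes w≡y = inj₂ (inj₁ w≡y)
  ... | no w≢x | no w≢y with Cyc-total (≢-sym w≢x) w≢y x≢y
  ...   | inj₁ xwy = ⊥-elim (w∉xy xwy)
  ...   | inj₂ ywx = inj₂ (inj₂ ywx)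

  module At (o : L) where

    infix 4 _≺_ _⪯_

    -- The linear order obtained by cutting the circle at o, with o as least element.
    _≺_ : L → L → Set ℓ
    x ≺ y = (x ≡ o × y ≢ o) ⊎ Cyc o x y

    _⪯_ : L → L → Set ℓ
    x ⪯ y = x ≺ y ⊎ x ≡ y

    ≺-irrefl : ∀ {x} → ¬ x ≺ x
    ≺-irrefl (inj₁ (x≡o , x≢o)) = x≢o x≡o
    ≺-irrefl (inj₂ oxx) = proj₁ (proj₂ (Cyc-distinct oxx)) refl

    ≺-trans : ∀ {x y z} → x ≺ y → y ≺ z → x ≺ z
    ≺-trans (inj₁ (_ , y≢o)) (inj₁ (y≡o , _)) = ⊥-elim (y≢o y≡o)
    ≺-trans (inj₁ (x≡o , _)) (inj₂ oyz) = inj₁ (x≡o , ≢-sym (proj₂ (proj₂ (Cyc-distinct oyz))))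
    ≺-trans (inj₂ oxy) (inj₁ (y≡o , _)) = ⊥-elim (proj₂ (proj₂ (Cyc-distinct oxy)) (sym y≡o))
    ≺-trans (inj₂ oxy) (inj₂ oyz) = inj₂ (Cyc-trans oxy oyz)

    ≺-asym : ∀ {x y} → x ≺ y → ¬ y ≺ x
    ≺-asym x≺y y≺x = ≺-irrefl (≺-trans x≺y y≺x)

    ≺⇒≢ : ∀ {x y} → x ≺ y → x ≢ y
    ≺⇒≢ x≺y refl = ≺-irrefl x≺y

    ≺-⪯-trans : ∀ {x y z} → x ≺ y → y ⪯ z → x ≺ z
    ≺-⪯-trans x≺y (inj₁ y≺z) = ≺-trans x≺y y≺z
    ≺-⪯-trans x≺y (inj₂ refl) = x≺y

    ⪯-≺-trans : ∀ {x y z} → x ⪯ y → y ≺ z → x ≺ z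
    ⪯-≺-trans (inj₁ x≺y) y≺z = ≺-trans x≺y y≺z
    ⪯-≺-trans (inj₂ refl) y≺z = y≺z

    o≺ : ∀ {x} → x ≢ o → o ≺ x
    o≺ x≢o = inj₁ (refl , x≢o)

    o⪯ : ∀ x → o ⪯ x
    o⪯ x with x ≟ o
    ... | yes x≡o = inj₂ (sym x≡o)
    ... | no x≢o = inj₁ (o≺ x≢o)

    ⋠o : ∀ {x} → x ≢ o → ¬ x ⪯ o
    ⋠o x≢o (inj₁ x≺o) = ≺-asym x≺o (o≺ x≢o)
    ⋠o x≢o (inj₂ x≡o) = x≢o x≡o

    ≺-compare : ∀ x y → Tri (x ≺ y) (x ≡ y) (y ≺ x)
    ≺-compare x y with x ≟ y | x ≟ o | y ≟ o
    ... | yes refl | _ | _ = tri≈ ≺-irrefl refl ≺-irrefl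
    ... | no x≢y | yes refl | _ = tri< (o≺ (≢-sym x≢y)) x≢y (≺-asym (o≺ (≢-sym x≢y)))
    ... | no x≢y | no _ | yes refl = tri> (≺-asym (o≺ x≢y)) x≢y (o≺ x≢y)
    ... | no x≢y | no x≢o | no y≢o with Cyc-total (≢-sym x≢o) x≢y (≢-sym y≢o)
    ...   | inj₁ oxy = tri< (inj₂ oxy) x≢y (≺-asym (inj₂ oxy))
    ...   | inj₂ yxo = tri> (≺-asym (inj₂ (Cyc-rotate⁻¹ yxo))) x≢y (inj₂ (Cyc-rotate⁻¹ yxo))

    ≺⇒Cyc : ∀ {x y z} → x ≺ y → y ≺ z → Cyc x y z
    ≺⇒Cyc (inj₁ (_ , y≢o)) (inj₁ (y≡o , _)) = ⊥-elim (y≢o y≡o)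
    ≺⇒Cyc (inj₁ (refl , _)) (inj₂ oyz) = oyz
    ≺⇒Cyc (inj₂ oxy) (inj₁ (y≡o , _)) = ⊥-elim (proj₂ (proj₂ (Cyc-distinct oxy)) (sym y≡o))
    ≺⇒Cyc (inj₂ oxy) (inj₂ oyz) = Cyc-chain oxy oyz

    Cyc⇒≺ : ∀ {x y z} → Cyc x y z → x ≺ z → x ≺ y × y ≺ z
    Cyc⇒≺ xyz (inj₁ (refl , _)) = o≺ (≢-sym (proj₁ (Cyc-distinct xyz))) , inj₂ xyz
    Cyc⇒≺ xyz (inj₂ oxz) = let (oxy , oyz) = Cyc-split oxz xyz in inj₂ oxy , inj₂ oyz

    ≺-dense : Dense _≺_
    ≺-dense (inj₁ (refl , y≢o)) =
      let (z , ozy) = Cyc-dense (≢-sym y≢o) in z , o≺ (≢-sym (proj₁ (Cyc-distinct ozy))) , inj₂ ozy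
    ≺-dense (inj₂ oxy) =
      let (z , xzy) = Cyc-dense (proj₁ (proj₂ (Cyc-distinct oxy))) in z , Cyc⇒≺ xzy (inj₂ oxy)

    ≺-noMax : ∀ x → ∃ λ y → x ≺ y
    ≺-noMax x with x ≟ o
    ... | no x≢o = let (z , xzo) = Cyc-dense x≢o in z , inj₂ (Cyc-rotate⁻¹ xzo)
    ... | yes refl with em {∃ λ z → z ≢ o}
    ...   | yes (z , z≢o) = z , o≺ z≢o
    ...   | no singleton =
      ⊥-elim (not-both-ends ((o , λ x → inj₂ (is-o x)) , (o , λ x → inj₂ (sym (is-o x)))))
      where
      is-o : ∀ x → o ≡ x
      is-o x with x ≟ o
      ... | yes x≡o = sym x≡o
      ... | no x≢o = ⊥-elim (singleton (x , x≢o))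

    ∉-arc⇒⪯ : ∀ {x y w} → y ≺ x → ¬ Cyc x w y → y ⪯ w × w ⪯ x
    ∉-arc⇒⪯ y≺x w∉xy with ∉-arc (≢-sym (≺⇒≢ y≺x)) w∉xy
    ... | inj₁ refl = inj₁ y≺x , inj₂ refl
    ... | inj₂ (inj₁ refl) = inj₂ refl , inj₁ y≺x
    ... | inj₂ (inj₂ ywx) = let (y≺w , w≺x) = Cyc⇒≺ ywx y≺x in inj₁ y≺w , inj₁ w≺x

    classify : ∀ w → w < o ⊎ w ≡ o ⊎ o < w
    classify w with compare w o
    ... | tri< w<o _ _ = inj₁ w<o
    ... | tri≈ _ w≡o _ = inj₂ (inj₁ w≡o)
    ... | tri> _ _ o<w = inj₂ (inj₂ o<w)

    -- Points below o come last in the cut order, points above o come first.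
    late-⪯ : ∀ {w b} → w < o → w ⪯ b → b < o × w ≤ b
    late-⪯ w<o (inj₂ refl) = w<o , inj₂ refl
    late-⪯ w<o (inj₁ (inj₁ (refl , _))) = ⊥-elim (<-irrefl w<o)
    late-⪯ w<o (inj₁ (inj₂ (inj₁ (o<w , _)))) = ⊥-elim (asym w<o o<w)
    late-⪯ w<o (inj₁ (inj₂ (inj₂ (inj₁ (w<b , b<o))))) = b<o , inj₁ w<b
    late-⪯ w<o (inj₁ (inj₂ (inj₂ (inj₂ (_ , o<w))))) = ⊥-elim (asym w<o o<w)

    late-⪯⁻¹ : ∀ {w b} → w < o → b < o → w ≤ b → w ⪯ b
    late-⪯⁻¹ _ b<o (inj₁ w<b) = inj₁ (inj₂ (inj₂ (inj₁ (w<b , b<o))))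
    late-⪯⁻¹ _ _ (inj₂ w≡b) = inj₂ w≡b

    early-⪯ : ∀ {w b} → o < w → o < b → w ⪯ b → w ≤ b
    early-⪯ _ _ (inj₂ refl) = inj₂ refl
    early-⪯ o<w _ (inj₁ (inj₁ (refl , _))) = ⊥-elim (<-irrefl o<w)
    early-⪯ _ _ (inj₁ (inj₂ (inj₁ (_ , w<b)))) = inj₁ w<b
    early-⪯ _ o<b (inj₁ (inj₂ (inj₂ (inj₁ (_ , b<o))))) = ⊥-elim (asym o<b b<o)
    early-⪯ _ o<b (inj₁ (inj₂ (inj₂ (inj₂ (b<o , _))))) = ⊥-elim (asym o<b b<o)

    early-⪯⁻¹ : ∀ {w b} → o < w → o < b → w ≤ b → w ⪯ b
    early-⪯⁻¹ o<w _ (inj₁ w<b) = inj₁ (inj₂ (inj₁ (o<w , w<b)))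
    early-⪯⁻¹ _ _ (inj₂ w≡b) = inj₂ w≡b

    early≺late : ∀ {w b} → o < w → b < o → w ≺ b
    early≺late o<w b<o = inj₂ (inj₂ (inj₂ (b<o , o<w)))

    module _ (A : L → Set ℓ) where

      Late Early : L → Set ℓ
      Late w = A w × w < o
      Early w = A w × o < w

      sup-with-late : ∀ {w₀ B} → Late w₀ → UpperBound _⪯_ A B → ∃ (IsSupremum _⪯_ A)
      sup-with-late {w₀} {B} (Aw₀ , w₀<o) A⪯B = s , upper , least
        where
        late-bounded : ∀ {b} → UpperBound _⪯_ A b → UpperBound _≤_ Late b
        late-bounded A⪯b w (Aw , w<o) = proj₂ (late-⪯ w<o (A⪯b w Aw))
        sup : ∃ (IsSupremum _≤_ Late)
        sup = complete Late (w₀ , Aw₀ , w₀<o) (B , late-bounded A⪯B)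
        s : L
        s = proj₁ sup
        s<o : s < o
        s<o = ≤-<-trans (proj₂ (proj₂ sup) B (late-bounded A⪯B)) (proj₁ (late-⪯ w₀<o (A⪯B w₀ Aw₀)))
        upper : UpperBound _⪯_ A s
        upper x Ax with classify x
        ... | inj₁ x<o = late-⪯⁻¹ x<o s<o (proj₁ (proj₂ sup) x (Ax , x<o))
        ... | inj₂ (inj₁ refl) = inj₁ (o≺ (<⇒≢ s<o))
        ... | inj₂ (inj₂ o<x) = inj₁ (early≺late o<x s<o)
        least : ∀ b → UpperBound _⪯_ A b → s ⪯ b
        least b A⪯b = late-⪯⁻¹ s<o (proj₁ (late-⪯ w₀<o (A⪯b w₀ Aw₀)))
                               (proj₂ (proj₂ sup) b (late-bounded A⪯b))

      module _ (no-late : ¬ ∃ Late) {w₀} (early-w₀ : Early w₀) where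

        o-not-bound : ¬ UpperBound _⪯_ A o
        o-not-bound A⪯o = ⋠o (≢-sym (<⇒≢ (proj₂ early-w₀))) (A⪯o w₀ (proj₁ early-w₀))

        sup-early-bounded : ∀ {b} → o < b → UpperBound _≤_ Early b → ∃ (IsSupremum _⪯_ A)
        sup-early-bounded {b} o<b Early≤b = s , upper , least
          where
          sup : ∃ (IsSupremum _≤_ Early)
          sup = complete Early (w₀ , early-w₀) (b , Early≤b)
          s : L
          s = proj₁ sup
          o<s : o < s
          o<s = <-≤-trans (proj₂ early-w₀) (proj₁ (proj₂ sup) w₀ early-w₀)
          upper : UpperBound _⪯_ A s
          upper x Ax with classify x
          ... | inj₁ x<o = ⊥-elim (no-late (x , Ax , x<o))
          ... | inj₂ (inj₁ refl) = inj₁ (o≺ (≢-sym (<⇒≢ o<s)))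
          ... | inj₂ (inj₂ o<x) = early-⪯⁻¹ o<x o<s (proj₁ (proj₂ sup) x (Ax , o<x))
          least : ∀ b′ → UpperBound _⪯_ A b′ → s ⪯ b′
          least b′ A⪯b′ with classify b′
          ... | inj₁ b′<o = inj₁ (early≺late o<s b′<o)
          ... | inj₂ (inj₁ refl) = ⊥-elim (o-not-bound A⪯b′)
          ... | inj₂ (inj₂ o<b′) =
            early-⪯⁻¹ o<s o<b′ (proj₂ (proj₂ sup) b′ (λ w (Aw , o<w) → early-⪯ o<w o<b′ (A⪯b′ w Aw)))

        -- An unbounded early part forces every upper bound to be late, so L has no maximum
        -- and its minimum is the supremum.
        sup-early-unbounded : ¬ (∃ λ b → o < b × UpperBound _≤_ Early b) → ∃ (UpperBound _⪯_ A) →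
                              ∃ (IsSupremum _⪯_ A)
        sup-early-unbounded unbounded (B , A⪯B) = m , upper , least
          where
          early-bound : ∀ {b} → o < b → ¬ UpperBound _⪯_ A b
          early-bound o<b A⪯b = unbounded (_ , o<b , λ w (Aw , o<w) → early-⪯ o<w o<b (A⪯b w Aw))
          late-bound : ∀ {b} → UpperBound _⪯_ A b → b < o
          late-bound {b} A⪯b with classify b
          ... | inj₁ b<o = b<o
          ... | inj₂ (inj₁ refl) = ⊥-elim (o-not-bound A⪯b)
          ... | inj₂ (inj₂ o<b) = ⊥-elim (early-bound o<b A⪯b)
          min-of : HasMin D ⊎ HasMax D → HasMin D
          min-of (inj₁ has-min) = has-min
          min-of (inj₂ (M , x≤M)) =
            ⊥-elim (unbounded (M , <-≤-trans (proj₂ early-w₀) (x≤M w₀) , λ w _ → x≤M w))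
          has-min : HasMin D
          has-min = min-of some-end
          m : L
          m = proj₁ has-min
          m<o : m < o
          m<o = ≤-<-trans (proj₂ has-min B) (late-bound A⪯B)
          upper : UpperBound _⪯_ A m
          upper x Ax with classify x
          ... | inj₁ x<o = ⊥-elim (no-late (x , Ax , x<o))
          ... | inj₂ (inj₁ refl) = inj₁ (o≺ (<⇒≢ m<o))
          ... | inj₂ (inj₂ o<x) = inj₁ (early≺late o<x m<o)
          least : ∀ b → UpperBound _⪯_ A b → m ⪯ b
          least b A⪯b = late-⪯⁻¹ m<o (late-bound A⪯b) (proj₂ has-min b)

    ≺-complete : Complete _⪯_
    ≺-complete A (a , Aa) A-bounded with em {∃ (Late A)}
    ... | yes (w₀ , late-w₀) = sup-with-late A late-w₀ (proj₂ A-bounded)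
    ... | no no-late with em {∃ (Early A)}
    ...   | no no-early = o , (λ x Ax → inj₂ (is-o x Ax)) , (λ b _ → o⪯ b)
      where
      is-o : ∀ x → A x → x ≡ o
      is-o x Ax with classify x
      ... | inj₁ x<o = ⊥-elim (no-late (x , Ax , x<o))
      ... | inj₂ (inj₁ x≡o) = x≡o
      ... | inj₂ (inj₂ o<x) = ⊥-elim (no-early (x , Ax , o<x))
    ...   | yes (w₀ , early-w₀) with em {∃ λ b → o < b × UpperBound _≤_ (Early A) b}
    ...     | yes (b , o<b , Early≤b) = sup-early-bounded A no-late early-w₀ o<b Early≤b
    ...     | no unbounded = sup-early-unbounded A no-late early-w₀ unbounded A-bounded

    order : CompleteDenseOrder L
    order = record
      { _⊏_ = _≺_
      ; isStrictTotalOrder = record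
        { isStrictPartialOrder = record
          { isEquivalence = isEquivalence
          ; irrefl = λ { refl → ≺-irrefl }
          ; trans = ≺-trans
          ; <-resp-≈ = (λ { refl x≺y → x≺y }) , (λ { refl x≺y → x≺y })
          }
        ; compare = ≺-compare
        }
      ; dense = ≺-dense
      ; complete = ≺-complete
      }

module CircularCase {ℓ} (em : ExcludedMiddle ℓ) (D : DLO ℓ) (complete : LinDedekindComplete D)
                    (not-both-ends : ¬ (HasMin D × HasMax D)) (some-end : HasMin D ⊎ HasMax D)
                    (G : Perm (DLO.Carrier D) → Set ℓ) (G-id : G idP)
                    (G-∘ : ∀ {p q} → G p → G q → G (p ∘P q)) (G-inv : ∀ {p} → G p → G (invP p))
                    (G-aut : ∀ {p} → G p → CrPres D (to p) ⊎ CrRev D (to p)) where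
  open DLO D renaming (Carrier to L)
  open IsStrictTotalOrder isSTO using (_≟_)
  open CyclicOrder D
  open CutOrder em D complete not-both-ends some-end

  Arc : Set ℓ
  Arc = Σ (L × L) λ p → proj₁ p ≢ proj₂ p

  _∈_ : L → Arc → Set ℓ
  z ∈ ((x , y) , _) = Cyc x z y

  CyclicConfig : (n : ℕ) → (Fin n → L) → (Fin n → Arc) → Set ℓ
  CyclicConfig n a I = (∀ i j → i ≢ j → a i ≢ a j × (∀ x → x ∈ I i → x ∈ I j → ⊥))
               × (∀ i j l → i Fin.< j → j Fin.< l →
                   Cyc (a i) (a j) (a l) × (∀ x y z → x ∈ I i → y ∈ I j → z ∈ I l → Cyc x y z))

  HighlyApproxTransitive OutwardTransitive Sweeping BoundedElement : Set ℓ
  HighlyApproxTransitive = ∀ n a I → CyclicConfig n a I → ∃ λ g → G g × (∀ i → to g (a i) ∈ I i)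
  OutwardTransitive =
    ∀ a b c → Cyc b a c → (I J : Arc) → (∀ z → z ∈ I → z ∈ J) → a ∈ I →
    ∃ λ g → G g × to g a ∈ I × ¬ (to g b ∈ J) × ¬ (to g c ∈ J)
  Sweeping = ∀ (I : Arc) a → a ∈ I → ∃ λ g → G g × Supp⊆ g (_∈ I) × to g a ≢ a
  BoundedElement = ∃ λ g → G g × (∃ λ z → to g z ≢ z) × ∃ λ (I : Arc) → Supp⊆ g (_∈ I)

  from-pres : ∀ {k} → CrPres D (to k) → CrPres D (from k)
  from-pres {k} k-pres x y z xyz =
    let (x≢y , y≢z , x≢z) = Cyc-distinct xyz
    in not-reversed (Cyc-total (λ eq → x≢y (from-injective k eq)) (λ eq → y≢z (from-injective k eq))
                              (λ eq → x≢z (from-injective k eq)))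
    where
    not-reversed : Cyc (from k x) (from k y) (from k z) ⊎ Cyc (from k z) (from k y) (from k x) →
                   Cyc (from k x) (from k y) (from k z)
    not-reversed (inj₁ k⁻¹xyz) = k⁻¹xyz
    not-reversed (inj₂ k⁻¹zyx) =
      ⊥-elim (Cyc-asym xyz (Cyc-resp (to-from k z) (to-from k y) (to-from k x) (k-pres _ _ _ k⁻¹zyx)))

  -- It fixes x, y and a point w outside (x , y), which an orientation-reversing map cannot do.
  bounded⇒orientation-preserving : ∀ {g} (I : Arc) → G g → Supp⊆ g (_∈ I) → CrPres D (to g)
  bounded⇒orientation-preserving {g} ((x , y) , x≢y) Gg g⊆I with G-aut Gg
  ... | inj₁ g-pres = g-pres
  ... | inj₂ g-rev =
    let (w , ywx) = Cyc-dense (≢-sym x≢y)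
        fixes : ∀ {z} → ¬ Cyc x z y → to g z ≡ z
        fixes = fixed-outside em {g} g⊆I
        xyw = Cyc-rotate⁻¹ ywx
        g-fixes-x = fixes (λ xxy → proj₁ (Cyc-distinct xxy) refl)
        g-fixes-y = fixes (λ xyy → proj₁ (proj₂ (Cyc-distinct xyy)) refl)
    in ⊥-elim (Cyc-asym xyw (Cyc-resp (fixes (Cyc-asym ywx)) g-fixes-y g-fixes-x (g-rev _ _ _ xyw)))

  module _ (o : L) where
    open At o

    Stab : OrderPreservingGroup order
    Stab = record
      { H      = λ g → G g × CrPres D (to g) × to g o ≡ o
      ; H-id   = G-id , (λ _ _ _ xyz → xyz) , refl
      ; H-∘    = λ {p} (Gp , p-pres , p-fixes) (Gq , q-pres , q-fixes) →
                 G-∘ Gp Gq , (λ _ _ _ xyz → p-pres _ _ _ (q-pres _ _ _ xyz)) ,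
                 trans (cong (to p) q-fixes) p-fixes
      ; H-inv  = λ {p} (Gp , p-pres , p-fixes) →
                 G-inv Gp , from-pres {p} p-pres , trans (cong (from p) (sym p-fixes)) (from-to p o)
      ; H-mono = λ {p} (_ , p-pres , p-fixes) → mono p p-pres p-fixes
      }
      where
      mono : ∀ p → CrPres D (to p) → to p o ≡ o → ∀ {x y} → x ≺ y → to p x ≺ to p y
      mono p _ p-fixes (inj₁ (refl , y≢o)) =
        inj₁ (p-fixes , λ py≡o → y≢o (to-injective p (trans py≡o (sym p-fixes))))
      mono p p-pres p-fixes (inj₂ oxy) = inj₂ (Cyc-resp p-fixes refl refl (p-pres _ _ _ oxy))

    open LocalDynamics order em Stab using (IsLocallySweeping)

    sweeping⇒locally-sweeping : Sweeping → IsLocallySweeping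
    sweeping⇒locally-sweeping sweep {u} {v} (u≺a , a≺v) =
      let u≺v = ≺-trans u≺a a≺v
          I = (u , v) , ≺⇒≢ u≺v
          (g , Gg , g⊆I , moved) = sweep I _ (≺⇒Cyc u≺a a≺v)
          o∉I : ¬ Cyc u o v
          o∉I uov = ⋠o (proj₁ (Cyc-distinct uov)) (inj₁ (proj₁ (Cyc⇒≺ uov u≺v)))
      in g , (Gg , bounded⇒orientation-preserving I Gg g⊆I , fixed-outside em {g} g⊆I o∉I) ,
         supp-mono {g = g} (λ uzv → Cyc⇒≺ uzv u≺v) g⊆I , moved

    module _ (sweep : Sweeping) where
      open LocalTransitivity order em Stab (sweeping⇒locally-sweeping sweep)
      open LocalDynamics order em Stab using (OpenInterval)

      move-into-arcs-fixing : ∀ m (b c d : Fin m → L) → (∀ j → Cyc o (c j) (d j)) → (∀ j → b j ≢ o) →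
                    (∀ i j → i Fin.< j → Cyc o (b i) (b j)) →
                    (∀ i j → i Fin.< j → ∀ x y → Cyc (c i) x (d i) → Cyc (c j) y (d j) → Cyc o x y) →
                    ∃ λ h → G h × CrPres D (to h) × to h o ≡ o × (∀ j → Cyc (c j) (to h (b j)) (d j))
      move-into-arcs-fixing m b c d ocd b≢o b-cyclic cd-cyclic =
        let J : Fin m → OpenInterval
            J j = (c j , d j) , inj₂ (ocd j)
            (h , (Gh , h-pres , h-fixes) , _ , moved) =
              move-increasing-above ≺-noMax m b J
                (λ i j i<j → inj₂ (b-cyclic i j i<j) ,
                             λ x y (ci≺x , x≺di) (cj≺y , y≺dj) →
                               inj₂ (cd-cyclic i j i<j x y (≺⇒Cyc ci≺x x≺di) (≺⇒Cyc cj≺y y≺dj)))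
                (λ j → o≺ (b≢o j))
                (λ j x (cj≺x , _) → ≺-trans (o≺ (≢-sym (proj₁ (Cyc-distinct (ocd j))))) cj≺x)
        in h , Gh , h-pres , h-fixes , λ j → ≺⇒Cyc (proj₁ (moved j)) (proj₂ (moved j))

  arc-point : (I : Arc) → ∃ (_∈ I)
  arc-point (_ , x≢y) = Cyc-dense x≢y

  config-triple : ∀ {a₀ a₁ a₂ I₀ I₁ I₂} → Cyc a₀ a₁ a₂ →
                  (∀ x y z → x ∈ I₀ → y ∈ I₁ → z ∈ I₂ → Cyc x y z) →
                  CyclicConfig 3 (a₀ ∷ a₁ ∷ a₂ ∷ []) (I₀ ∷ I₁ ∷ I₂ ∷ [])
  config-triple {a₀} {a₁} {a₂} {I₀} {I₁} {I₂} a₀a₁a₂ arcs = distinct , cyclic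
    where
    a : Fin 3 → L
    a = a₀ ∷ a₁ ∷ a₂ ∷ []
    I : Fin 3 → Arc
    I = I₀ ∷ I₁ ∷ I₂ ∷ []
    a₀≢a₁ : a₀ ≢ a₁
    a₀≢a₁ = proj₁ (Cyc-distinct a₀a₁a₂)
    a₁≢a₂ : a₁ ≢ a₂
    a₁≢a₂ = proj₁ (proj₂ (Cyc-distinct a₀a₁a₂))
    a₀≢a₂ : a₀ ≢ a₂
    a₀≢a₂ = proj₂ (proj₂ (Cyc-distinct a₀a₁a₂))
    disjoint₀₁ : ∀ x → x ∈ I₀ → x ∈ I₁ → ⊥
    disjoint₀₁ x x∈I₀ x∈I₁ = let (z , z∈I₂) = arc-point I₂
                             in proj₁ (Cyc-distinct (arcs x x z x∈I₀ x∈I₁ z∈I₂)) refl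
    disjoint₀₂ : ∀ x → x ∈ I₀ → x ∈ I₂ → ⊥
    disjoint₀₂ x x∈I₀ x∈I₂ = let (y , y∈I₁) = arc-point I₁
                             in proj₂ (proj₂ (Cyc-distinct (arcs x y x x∈I₀ y∈I₁ x∈I₂))) refl
    disjoint₁₂ : ∀ x → x ∈ I₁ → x ∈ I₂ → ⊥
    disjoint₁₂ x x∈I₁ x∈I₂ = let (w , w∈I₀) = arc-point I₀
                             in proj₁ (proj₂ (Cyc-distinct (arcs w x x w∈I₀ x∈I₁ x∈I₂))) refl
    distinct : ∀ i j → i ≢ j → a i ≢ a j × (∀ x → x ∈ I i → x ∈ I j → ⊥)
    distinct Fin.zero Fin.zero i≢j = ⊥-elim (i≢j refl)
    distinct Fin.zero (Fin.suc Fin.zero) _ = a₀≢a₁ , disjoint₀₁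
    distinct Fin.zero (Fin.suc (Fin.suc Fin.zero)) _ = a₀≢a₂ , disjoint₀₂
    distinct (Fin.suc Fin.zero) Fin.zero _ = ≢-sym a₀≢a₁ , λ x p q → disjoint₀₁ x q p
    distinct (Fin.suc Fin.zero) (Fin.suc Fin.zero) i≢j = ⊥-elim (i≢j refl)
    distinct (Fin.suc Fin.zero) (Fin.suc (Fin.suc Fin.zero)) _ = a₁≢a₂ , disjoint₁₂
    distinct (Fin.suc (Fin.suc Fin.zero)) Fin.zero _ = ≢-sym a₀≢a₂ , λ x p q → disjoint₀₂ x q p
    distinct (Fin.suc (Fin.suc Fin.zero)) (Fin.suc Fin.zero) _ = ≢-sym a₁≢a₂ , λ x p q → disjoint₁₂ x q p
    distinct (Fin.suc (Fin.suc Fin.zero)) (Fin.suc (Fin.suc Fin.zero)) i≢j = ⊥-elim (i≢j refl)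
    cyclic : ∀ i j l → i Fin.< j → j Fin.< l →
             Cyc (a i) (a j) (a l) × (∀ x y z → x ∈ I i → y ∈ I j → z ∈ I l → Cyc x y z)
    cyclic Fin.zero (Fin.suc Fin.zero) (Fin.suc (Fin.suc Fin.zero)) _ _ = a₀a₁a₂ , arcs
    cyclic _ Fin.zero _ () _
    cyclic _ (Fin.suc Fin.zero) Fin.zero _ ()
    cyclic _ (Fin.suc Fin.zero) (Fin.suc Fin.zero) _ (s≤s ())
    cyclic (Fin.suc Fin.zero) (Fin.suc Fin.zero) _ (s≤s ()) _
    cyclic (Fin.suc (Fin.suc Fin.zero)) (Fin.suc Fin.zero) _ (s≤s ()) _
    cyclic _ (Fin.suc (Fin.suc Fin.zero)) Fin.zero _ ()
    cyclic _ (Fin.suc (Fin.suc Fin.zero)) (Fin.suc Fin.zero) _ (s≤s ())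
    cyclic _ (Fin.suc (Fin.suc Fin.zero)) (Fin.suc (Fin.suc Fin.zero)) _ (s≤s (s≤s ()))

  record InnerArc (I : Arc) : Set ℓ where
    open At (proj₁ (proj₁ I))
    field
      c d : L
      lo≺c : proj₁ (proj₁ I) ≺ c
      c≺d : c ≺ d
      d≺hi : d ≺ proj₂ (proj₁ I)

    c∈I : c ∈ I
    c∈I = ≺⇒Cyc lo≺c (≺-trans c≺d d≺hi)

    d∈I : d ∈ I
    d∈I = ≺⇒Cyc (≺-trans lo≺c c≺d) d≺hi

    ⊆I : ∀ {z} → Cyc c z d → z ∈ I
    ⊆I czd = let (c≺z , z≺d) = Cyc⇒≺ czd c≺d in ≺⇒Cyc (≺-trans lo≺c c≺z) (≺-trans z≺d d≺hi)

    lo-c-d : Cyc (proj₁ (proj₁ I)) c d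
    lo-c-d = ≺⇒Cyc lo≺c c≺d

    c-d-hi : Cyc c d (proj₂ (proj₁ I))
    c-d-hi = ≺⇒Cyc c≺d d≺hi

    from-outside : ∀ {p} → ¬ p ∈ I → Cyc p c d
    from-outside p∉I with Cyc-total (λ { refl → p∉I c∈I }) (≺⇒≢ c≺d)
                                        (λ { refl → p∉I d∈I })
    ... | inj₁ pcd = pcd
    ... | inj₂ dcp = ⊥-elim (p∉I (⊆I (Cyc-rotate dcp)))

  inner-arc : (I : Arc) → InnerArc I
  inner-arc ((x , y) , x≢y) =
    let open At x
        (c , xcy) = Cyc-dense x≢y
        (d , cdy) = Cyc-dense (proj₁ (proj₂ (Cyc-distinct xcy)))
        (c≺d , d≺y) = Cyc⇒≺ cdy (inj₂ xcy)
    in record { c = c ; d = d ; lo≺c = o≺ (≢-sym (proj₁ (Cyc-distinct xcy))) ; c≺d = c≺d ; d≺hi = d≺y }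

  base-point : ∀ {I} (J : InnerArc I) a → ∃ λ o → a ≢ o × Cyc o (InnerArc.c J) (InnerArc.d J)
  base-point {(x , y) , x≢y} J a with a ≟ x
  ... | yes refl = y , x≢y , Cyc-rotate⁻¹ (InnerArc.c-d-hi J)
  ... | no a≢x = x , a≢x , InnerArc.lo-c-d J

  -- Move the first point into its arc, then cut the circle at its image and move the rest
  -- by an element fixing it.
  sweeping⇒highly-transitive : Sweeping → HighlyApproxTransitive
  sweeping⇒highly-transitive sweep zero a I _ = idP , G-id , λ ()
  sweeping⇒highly-transitive sweep (suc m) a I (distinct , cyclic) =
    let J₀ = inner-arc (I Fin.zero)
        (o , a₀≢o , ocd) = base-point J₀ (a Fin.zero)
        (g , Gg , g-pres , _ , moved₀) =
          move-into-arcs-fixing o sweep 1 (λ _ → a Fin.zero) (λ _ → InnerArc.c J₀) (λ _ → InnerArc.d J₀)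
            (λ _ → ocd) (λ _ → a₀≢o) (λ { Fin.zero Fin.zero () }) (λ { Fin.zero Fin.zero () })
        p = to g (a Fin.zero)
        p∈I₀ = InnerArc.⊆I J₀ (moved₀ Fin.zero)
        J : ∀ j → InnerArc (I (Fin.suc j))
        J j = inner-arc (I (Fin.suc j))
        first-before = λ i j i<j → cyclic Fin.zero (Fin.suc i) (Fin.suc j) (s≤s z≤n) (s≤s i<j)
        (h , Gh , _ , h-fixes-p , moved) =
          move-into-arcs-fixing p sweep m (λ j → to g (a (Fin.suc j)))
            (λ j → InnerArc.c (J j)) (λ j → InnerArc.d (J j))
            (λ j → InnerArc.from-outside (J j) (proj₂ (distinct Fin.zero (Fin.suc j) (λ ())) p p∈I₀))
            (λ j gaⱼ≡p → proj₁ (distinct (Fin.suc j) Fin.zero (λ ())) (to-injective g gaⱼ≡p))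
            (λ i j i<j → g-pres _ _ _ (proj₁ (first-before i j i<j)))
            (λ i j i<j x y x∈ y∈ → proj₂ (first-before i j i<j) p x y p∈I₀ (InnerArc.⊆I (J i) x∈)
                                                                        (InnerArc.⊆I (J j) y∈))
    in h ∘P g , G-∘ Gh Gg ,
       λ { Fin.zero → subst (_∈ I Fin.zero) (sym h-fixes-p) p∈I₀
         ; (Fin.suc j) → InnerArc.⊆I (J j) (moved j) }

  -- Send b and c to two arcs following J, in the order that keeps (b , a , c) cyclic.
  highly-transitive⇒outward : HighlyApproxTransitive → OutwardTransitive
  highly-transitive⇒outward transitive a b c bac I J@((x , y) , x≢y) I⊆J a∈I =
    let (g , Gg , moved) = transitive 3 (b ∷ a ∷ c ∷ []) (K₀ ∷ I ∷ K₂ ∷ []) (config-triple bac arcs-cyclic)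
    in g , Gg , moved (Fin.suc Fin.zero) ,
       (λ gb∈J → ≺-asym (in-J gb∈J) (≺-trans y≺p₁ (in-K₀ (moved Fin.zero)))) ,
       (λ gc∈J → ≺-asym (in-J gc∈J) (proj₁ (in-K₂ (moved (Fin.suc (Fin.suc Fin.zero))))))
    where
    open At x
    p₁ p₂ : L
    p₁ = proj₁ (≺-noMax y)
    p₂ = proj₁ (≺-noMax p₁)
    y≺p₁ : y ≺ p₁
    y≺p₁ = proj₂ (≺-noMax y)
    p₁≺p₂ : p₁ ≺ p₂
    p₁≺p₂ = proj₂ (≺-noMax p₁)
    K₀ K₂ : Arc
    K₀ = (p₁ , p₂) , ≺⇒≢ p₁≺p₂
    K₂ = (y , p₁) , ≺⇒≢ y≺p₁
    in-J : ∀ {z} → z ∈ J → z ≺ y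
    in-J xzy = proj₂ (Cyc⇒≺ xzy (o≺ (≢-sym x≢y)))
    in-K₀ : ∀ {z} → z ∈ K₀ → p₁ ≺ z
    in-K₀ p₁zp₂ = proj₁ (Cyc⇒≺ p₁zp₂ p₁≺p₂)
    in-K₂ : ∀ {z} → z ∈ K₂ → y ≺ z × z ≺ p₁
    in-K₂ yzp₁ = Cyc⇒≺ yzp₁ y≺p₁
    arcs-cyclic : ∀ u w z → u ∈ K₀ → w ∈ I → z ∈ K₂ → Cyc u w z
    arcs-cyclic u w z u∈K₀ w∈I z∈K₂ =
      Cyc-rotate⁻¹ (≺⇒Cyc (≺-trans (in-J (I⊆J w w∈I)) (proj₁ (in-K₂ z∈K₂)))
                          (≺-trans (proj₂ (in-K₂ z∈K₂)) (in-K₀ u∈K₀)))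

  point-other-than : (I : Arc) → ∀ p → ∃ λ a → a ≢ p × a ∈ I
  point-other-than I p = choose (p ≟ c)
    where
    open InnerArc (inner-arc I)
    choose : Dec (p ≡ c) → ∃ λ a → a ≢ p × a ∈ I
    choose (yes refl) = d , ≢-sym (proj₁ (proj₂ (Cyc-distinct lo-c-d))) , d∈I
    choose (no p≢c) = c , ≢-sym p≢c , c∈I

  -- Outward transitivity applied to the arc (x′ , y′) running the long way from t₂ to t₁
  -- pushes d into the short arc [y′ , x′] ⊆ (t₁ , t₂).
  move-into-arc : OutwardTransitive → ∀ d {t₁ t₂} → t₁ ≢ t₂ → ∃ λ g → G g × Cyc t₁ (to g d) t₂
  move-into-arc outward d {t₁} t₁≢t₂ =
    let open At t₁
        (y′ , t₁≺y′ , y′≺t₂) = ≺-dense (o≺ (≢-sym t₁≢t₂))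
        (x′ , y′≺x′ , x′≺t₂) = ≺-dense y′≺t₂
        K = (x′ , y′) , ≢-sym (≺⇒≢ y′≺x′)
        (a , a≢d , a∈K) = point-other-than K d
        (w , awd) = Cyc-dense a≢d
        (g , Gg , _ , gd∉K , _) = outward a d w (Cyc-rotate⁻¹ awd) K K (λ _ z∈K → z∈K) a∈K
        (y′⪯gd , gd⪯x′) = ∉-arc⇒⪯ y′≺x′ gd∉K
    in g , Gg , ≺⇒Cyc (≺-⪯-trans t₁≺y′ y′⪯gd) (⪯-≺-trans gd⪯x′ x′≺t₂)

  record Bump : Set ℓ where
    field
      f        : Perm L
      Gf       : G f
      support  : Arc
      f⊆       : Supp⊆ f (_∈ support)
      z        : L
      z≢fz     : z ≢ to f z
      moves-on : ∀ {w} → Cyc z w (to f z) → to f w ≢ w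

  bounded⇒bump : BoundedElement → Bump
  bounded⇒bump (f₀ , Gf₀ , (z , moved) , I@((x , _) , _) , f₀⊆I) =
    let open At x
        open OrderPreservingGroup (Stab x) using (H-mono)
        open LocalDynamics order em (Stab x) using (moves⇒pushes-up)
        f₀-fixes-x = fixed-outside em {f₀} f₀⊆I (λ xxy → proj₁ (Cyc-distinct xxy) refl)
        Hf₀ = Gf₀ , bounded⇒orientation-preserving I Gf₀ f₀⊆I , f₀-fixes-x
        (f , Hf , f⊆I , z≺fz) = moves⇒pushes-up Hf₀ f₀⊆I moved
        moves-on : ∀ {w} → Cyc z w (to f z) → to f w ≢ w
        moves-on zwfz = let (z≺w , w≺fz) = Cyc⇒≺ zwfz z≺fz
                        in ≢-sym (≺⇒≢ (≺-trans w≺fz (H-mono Hf z≺w)))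
    in record { f = f ; Gf = proj₁ Hf ; support = I ; f⊆ = f⊆I ; z = z ; z≢fz = ≺⇒≢ z≺fz
              ; moves-on = moves-on }

  arc-unseparated : ∀ {x y p q r s} → x ≢ y → Cyc x p y → Cyc x q y → ¬ Cyc x r y → ¬ Cyc x s y →
                    Cyc r p s → Cyc s q r → ⊥
  arc-unseparated {x} {y} {p} {q} {r} {s} x≢y xpy xqy r∉ s∉ rps sqr = separated (side r∉) (side s∉)
    where
    open At x
    x≺y : x ≺ y
    x≺y = o≺ (≢-sym x≢y)
    side : ∀ {t} → ¬ Cyc x t y → t ≡ x ⊎ y ⪯ t
    side {t} t∉ with t ≟ x | ≺-compare t y
    ... | yes t≡x | _ = inj₁ t≡x
    ... | no t≢x | tri< t≺y _ _ = ⊥-elim (t∉ (≺⇒Cyc (o≺ t≢x) t≺y))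
    ... | no _ | tri≈ _ t≡y _ = inj₂ (inj₂ (sym t≡y))
    ... | no _ | tri> _ _ y≺t = inj₂ (inj₁ y≺t)
    order-of : ∀ {t u w} → t ≺ u → t ≺ w → Cyc u t w → w ≺ u
    order-of {u = u} {w} t≺u _ utw with ≺-compare u w
    ... | tri< u≺w _ _ = ⊥-elim (Cyc-asym utw (Cyc-rotate⁻¹ (≺⇒Cyc t≺u u≺w)))
    ... | tri≈ _ u≡w _ = ⊥-elim (proj₂ (proj₂ (Cyc-distinct utw)) u≡w)
    ... | tri> _ _ w≺u = w≺u
    p≺y : p ≺ y
    p≺y = inj₂ xpy
    q≺y : q ≺ y
    q≺y = inj₂ xqy
    separated : r ≡ x ⊎ y ⪯ r → s ≡ x ⊎ y ⪯ s → ⊥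
    separated (inj₁ refl) (inj₁ refl) = proj₂ (proj₂ (Cyc-distinct rps)) refl
    separated (inj₁ refl) (inj₂ y⪯s) = ≺-asym (≺-⪯-trans q≺y y⪯s) (inj₂ (Cyc-rotate⁻¹ sqr))
    separated (inj₂ y⪯r) (inj₁ refl) = ≺-asym (≺-⪯-trans p≺y y⪯r) (inj₂ (Cyc-rotate⁻¹ rps))
    separated (inj₂ y⪯r) (inj₂ y⪯s) =
      ≺-asym (order-of (≺-⪯-trans p≺y y⪯r) (≺-⪯-trans p≺y y⪯s) rps)
             (order-of (≺-⪯-trans q≺y y⪯s) (≺-⪯-trans q≺y y⪯r) sqr)

  preimage-⊆-arc : ∀ {k x y u v a w} → G k → x ≢ y → u ≢ v → Cyc u a v → Cyc x (to k a) y →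
                   ¬ Cyc x (to k u) y → ¬ Cyc x (to k v) y → Cyc x (to k w) y → Cyc u w v
  preimage-⊆-arc {k} {u = u} {v} {w = w} Gk x≢y u≢v uav ka∈J ku∉J kv∉J kw∈J with em {Cyc u w v}
  ... | yes uwv = uwv
  ... | no w∉uv = ⊥-elim (separated (Cyc-total u≢w w≢v u≢v) (G-aut Gk))
    where
    u≢w : u ≢ w
    u≢w refl = ku∉J kw∈J
    w≢v : w ≢ v
    w≢v refl = kv∉J kw∈J
    separated : Cyc u w v ⊎ Cyc v w u → CrPres D (to k) ⊎ CrRev D (to k) → ⊥
    separated (inj₁ uwv) _ = w∉uv uwv
    separated (inj₂ vwu) (inj₁ k-pres) =
      arc-unseparated x≢y ka∈J kw∈J ku∉J kv∉J (k-pres _ _ _ uav) (k-pres _ _ _ vwu)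
    separated (inj₂ vwu) (inj₂ k-rev) =
      arc-unseparated x≢y ka∈J kw∈J kv∉J ku∉J (k-rev _ _ _ uav) (k-rev _ _ _ vwu)

  push-ends-out : OutwardTransitive → ∀ {h u a v} → G h → Cyc u a v → (I J : Arc) → (∀ z → z ∈ I → z ∈ J) →
                  to h a ∈ I → ∃ λ g → G g × to g (to h a) ∈ I × ¬ to g (to h u) ∈ J × ¬ to g (to h v) ∈ J
  push-ends-out outward Gh uav I J I⊆J ha∈I with G-aut Gh
  ... | inj₁ h-pres = outward _ _ _ (h-pres _ _ _ uav) I J I⊆J ha∈I
  ... | inj₂ h-rev =
    let (g , Gg , gha∈I , ghv∉J , ghu∉J) = outward _ _ _ (h-rev _ _ _ uav) I J I⊆J ha∈I
    in g , Gg , gha∈I , ghu∉J , ghv∉J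

  -- Move a into the arc (z , f z) moved by the bump, push u and v out of its support,
  -- and conjugate the bump back.
  outward⇒sweeping : BoundedElement → OutwardTransitive → Sweeping
  outward⇒sweeping bounded outward ((u , v) , u≢v) a uav =
    let open Bump (bounded⇒bump bounded)
        K = (z , to f z) , z≢fz
        K⊆support : ∀ w → w ∈ K → w ∈ support
        K⊆support w zwfz = f⊆ w (moves-on zwfz)
        (h , Gh , ha∈K) = move-into-arc outward a z≢fz
        (g , Gg , gha∈K , ghu∉J , ghv∉J) = push-ends-out outward Gh uav K support K⊆support ha∈K
        k = g ∘P h
        Gk = G-∘ Gg Gh
    in conj (invP k) f , G-∘ (G-inv Gk) (G-∘ Gf Gk) ,
       supp-mono {g = conj (invP k) f}
         (preimage-⊆-arc Gk (proj₂ support) u≢v uav (K⊆support _ gha∈K) ghu∉J ghv∉J)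
         (supp-conj em {invP k} {f} f⊆) ,
       conj-moves {k = invP k} {f} (moves-on gha∈K)

  equivalences : BoundedElement →
                 (HighlyApproxTransitive ⇔ OutwardTransitive) × (OutwardTransitive ⇔ Sweeping)
  equivalences bounded =
    mk⇔ highly-transitive⇒outward (sweeping⇒highly-transitive ∘ outward⇒sweeping bounded) ,
    mk⇔ (outward⇒sweeping bounded) (highly-transitive⇒outward ∘ sweeping⇒highly-transitive)

theorem12p14 : ∀ {ℓ : Level} → ExcludedMiddle ℓ →
    (D : DLO ℓ) (k : Kind) (N : NOPG D k) →
    HasNonidBoundedElement D N → DedekindComplete D k →
    (HighlyApproxOTransitive D N ⇔ Condition2 D N)
      × (Condition2 D N ⇔ LocallySweeping D N)
theorem12p14 em D linear N bounded complete =
  LinearCase.equivalences em D complete (proj₁ endpoints) (proj₂ endpoints)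
    G G-id G-∘ G-inv (inj₁ ∘ G-aut) bounded
  where open NOPG N
theorem12p14 em D monotonic N bounded complete =
  LinearCase.equivalences em D complete (proj₁ endpoints) (proj₂ endpoints)
    G G-id G-∘ G-inv G-aut bounded
  where open NOPG N
theorem12p14 em D circular N bounded (complete , some-end) =
  CircularCase.equivalences em D complete endpoints some-end
    G G-id G-∘ G-inv (inj₁ ∘ G-aut) bounded
  where open NOPG N
theorem12p14 em D monocircular N bounded (complete , some-end) =
  CircularCase.equivalences em D complete endpoints some-end
    G G-id G-∘ G-inv G-aut bounded
  where open NOPG N
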